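{- Let $k,s\ge1$, $R_{k,s}=\mathbb{F}_{4^{2k}}[u_1,\dots,u_s]/\langle u_1^2-u_1,\dots,u_s^2-u_s\rangle$, $\theta$ the automorphism with $\theta(a)=a^{4^k}$ ($a\in\mathbb{F}_{4^{2k}}$) and $\theta(u_i)=u_i+1$, and let $n$ be even. Let $g(x)\in R_{k,s}[x;\theta]$ be a right divisor of $x^n-1$ in $R_{k,s}[x;\theta]$ of even degree, and let $C=(g(x))$ be the skew cyclic code of length $n$ it generates. If $g(x)$ is palindromic, then $\varphi(C)$ is a reversible DNA code.
   Context: $R_{k,s}[x;\theta]$ is the skew polynomial ring: usual addition, multiplication determined by $xa=\theta(a)x$ for $a\in R_{k,s}$. $C=(g(x))$ is the left $R_{k,s}[x;\theta]$-submodule of $R_{k,s}[x;\theta]/(x^n-1)$ generated by $g(x)$; vectors $(c_0,\dots,c_{n-1})\in R_{k,s}^n$ are identified with $c_0+c_1x+\cdots+c_{n-1}x^{n-1}$. A polynomial $f=a_0+\cdots+a_tx^t$ of degree $t$ is palindromic if $a_i=a_{t-i}$ for all $i$, and $\theta$-palindromic if $a_i=\theta(a_{t-i})$ for all $i$. Gray map: let $T_0,\dots,T_{2^s-1}$ list $\{0,1\}^s$ ordered by increasing number of ones and, within equal numbers of ones, decreasing lexicographic order; for $T_i=(r_1,\dots,r_s)$ let $I_i=\theta^{r_1}(u_1)\cdots\theta^{r_s}(u_s)$ ($\theta^0(u_j)=u_j$, $\theta^1(u_j)=u_j+1$); each $\alpha\in R_{k,s}$ is uniquely $\sum_i\alpha_iI_i$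 with $\alpha_i\in\mathbb{F}_{4^{2k}}$ and $\varphi(\alpha)=(\alpha_0,\dots,\alpha_{2^s-1})$; on $R_{k,s}^n$, $\varphi(c_0,\dots,c_{n-1})=(\varphi(c_0),\dots,\varphi(c_{n-1}))$. DNA reverse: the DNA reverse of $(\alpha_0,\dots,\alpha_{2^s-1})\in\mathbb{F}_{4^{2k}}^{2^s}$ is $(\theta(\alpha_{2^s-1}),\dots,\theta(\alpha_0))$, and the DNA reverse of $\varphi(c)$ for $c=(c_0,\dots,c_{n-1})$ is $(\varphi(\theta(c_{n-1})),\dots,\varphi(\theta(c_0)))$. A code $C\subseteq R_{k,s}^n$ (equivalently $\varphi(C)$) is a reversible DNA code if for every $c\in C$ the DNA reverse of $\varphi(c)$ lies in $\varphi(C)$. -}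

module Defs where

open import Level using (0ℓ)
open import Data.Nat using (ℕ; zero; suc; _^_; _*_; _<_; _∸_; _≤_)
open import Data.Bool using (Bool; true; false)
open import Data.Fin using (Fin)
open import Data.List as L using (List; []; _∷_; _++_; concatMap; upTo; length; replicate)
open import Data.Vec as V using (Vec; lookup)
open import Data.Product using (Σ; ∃; ∃-syntax; _×_; _,_)
open import Relation.Binary.PropositionalEquality using (_≡_; _≢_)
open import Algebra.Structures using (IsCommutativeRing)
open import Function.Bundles using (_↔_)

record FiniteField (q : ℕ) : Set₁ where
  infixl 6 _+_
  infixl 7 _·_
  field
    Carrier  : Set
    _+_ _·_  : Carrier → Carrier → Carrier
    -_       : Carrier → Carrier
    0# 1#    : Carrier
    isCommutativeRing : IsCommutativeRing _≡_ _+_ _·_ -_ 0# 1#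
    0≢1      : 0# ≢ 1#
    inverse  : ∀ x → x ≢ 0# → ∃[ y ] (x · y ≡ 1#)
    card     : Fin q ↔ Carrier

module Skew (k : ℕ) (FF : FiniteField (4 ^ (2 * k))) where
  open FiniteField FF

  F : Set
  F = Carrier

  powF : F → ℕ → F
  powF a zero    = 1#
  powF a (suc m) = a · powF a m

  θF : F → F
  θF a = powF a (4 ^ k)

  -- R_{k,s} = F[u_1,…,u_s]/⟨u_i² - u_i⟩, built iteratively:
  -- R_0 = F, and R_{s+1} = R'[u_1]/⟨u_1² - u_1⟩ where R' ≅ F[u_2,…,u_{s+1}]/⟨…⟩
  -- is a copy of R_s; an element (a , b) stands for a + b·u_1 (normal form).

  data R : ℕ → Set where
    ⟨_⟩   : F → R zero
    _+u_ : ∀ {s} → R s → R s → R (suc s)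

  zeroR : ∀ s → R s
  zeroR zero    = ⟨ 0# ⟩
  zeroR (suc s) = zeroR s +u zeroR s

  oneR : ∀ s → R s
  oneR zero    = ⟨ 1# ⟩
  oneR (suc s) = oneR s +u zeroR s

  addR : ∀ {s} → R s → R s → R s
  addR ⟨ a ⟩ ⟨ b ⟩ = ⟨ a + b ⟩
  addR (a +u b) (c +u d) = addR a c +u addR b d

  negR : ∀ {s} → R s → R s
  negR ⟨ a ⟩ = ⟨ - a ⟩
  negR (a +u b) = negR a +u negR b

  -- (a + b u)(c + d u) = ac + (ad + bc + bd) u   (using u² = u)
  mulR : ∀ {s} → R s → R s → R s
  mulR ⟨ a ⟩ ⟨ b ⟩ = ⟨ a · b ⟩
  mulR (a +u b) (c +u d) =
    mulR a c +u addR (addR (mulR a d) (mulR b c)) (mulR b d)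

  embF : ∀ {s} → F → R s
  embF {zero}  a = ⟨ a ⟩
  embF {suc s} a = embF a +u zeroR s

  -- the variable u_1 of R_{s+1}, and the inclusion of R' (variables u_2,…)
  u₁ : ∀ {s} → R (suc s)
  u₁ {s} = zeroR s +u oneR s

  inner : ∀ {s} → R s → R (suc s)
  inner {s} a = a +u zeroR s

  -- θ on R_s: θ(a) = a^(4^k) on F and θ(u_i) = u_i + 1, extended as a ring map:
  -- θ(a + b u) = θ(a) + θ(b)(u + 1) = (θa + θb) + θb·u
  θR : ∀ {s} → R s → R s
  θR ⟨ a ⟩ = ⟨ θF a ⟩
  θR (a +u b) = addR (θR a) (θR b) +u θR b

  θpow : ∀ {s} → ℕ → R s → R s
  θpow zero    a = a
  θpow (suc i) a = θR (θpow i a)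

  -- Skew polynomials R_{k,s}[x;θ] as coefficient lists (a_0 first),
  -- with multiplication determined by x a = θ(a) x.

  Poly : ℕ → Set
  Poly s = List (R s)

  coeff : ∀ {s} → Poly s → ℕ → R s
  coeff {s} []      _       = zeroR s
  coeff     (a ∷ f) zero    = a
  coeff     (a ∷ f) (suc i) = coeff f i

  _≈P_ : ∀ {s} → Poly s → Poly s → Set
  f ≈P g = ∀ i → coeff f i ≡ coeff g i

  addP : ∀ {s} → Poly s → Poly s → Poly s
  addP []      g       = g
  addP (a ∷ f) []      = a ∷ f
  addP (a ∷ f) (b ∷ g) = addR a b ∷ addP f g

  -- (a + x f) g = a g + x (f g),  and  x (Σ h_j x^j) = Σ θ(h_j) x^(j+1)
  mulP : ∀ {s} → Poly s → Poly s → Poly s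
  mulP []      g = []
  mulP {s} (a ∷ f) g = addP (L.map (mulR a) g) (zeroR s ∷ L.map θR (mulP f g))

  xⁿ-1 : ∀ s → ℕ → Poly s
  xⁿ-1 s n = addP (replicate n (zeroR s) ++ (oneR s ∷ [])) (negR (oneR s) ∷ [])

  HasDegree : ∀ {s} → Poly s → ℕ → Set
  HasDegree {s} f t = (coeff f t ≢ zeroR s) × (∀ i → t < i → coeff f i ≡ zeroR s)

  Palindromic : ∀ {s} → Poly s → ℕ → Set
  Palindromic f t = HasDegree f t × (∀ i → i ≤ t → coeff f i ≡ coeff f (t ∸ i))

  RightDivides : ∀ {s} → Poly s → ℕ → Set
  RightDivides {s} g n = ∃[ h ] (mulP h g ≈P xⁿ-1 s n)

  -- C = (g(x)): left submodule of R[x;θ]/(x^n - 1) generated by g, i.e. the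
  -- words c whose polynomial c_0 + … + c_{n-1}x^{n-1} is ≡ f g modulo the
  -- left ideal generated by x^n - 1.
  InCode : ∀ {s n} → Poly s → Vec (R s) n → Set
  InCode {s} {n} g c =
    ∃[ f ] ∃[ q ] (mulP f g ≈P addP (mulP q (xⁿ-1 s n)) (V.toList c))

  -- Gray map.
  -- withOnes s w : vectors in {0,1}^s with exactly w ones, in decreasing
  -- lexicographic order (1 > 0, first coordinate most significant).
  withOnes : (s w : ℕ) → List (Vec Bool s)
  withOnes zero    zero    = V.[] ∷ []
  withOnes zero    (suc w) = []
  withOnes (suc s) zero    = L.map (false V.∷_) (withOnes s zero)
  withOnes (suc s) (suc w) =
    L.map (true V.∷_) (withOnes s w) ++ L.map (false V.∷_) (withOnes s (suc w))

  -- T_0, …, T_{2^s - 1}: increasing number of ones, then decreasing lex order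
  Ts : (s : ℕ) → List (Vec Bool s)
  Ts s = concatMap (withOnes s) (upTo (suc s))

  -- θ^0(u_j) = u_j, θ^1(u_j) = u_j + 1 (in R_{s+1} with u_j = u_1)
  θᵇu₁ : ∀ {s} → Bool → R (suc s)
  θᵇu₁ false = u₁
  θᵇu₁ {s} true = addR u₁ (oneR (suc s))

  -- I(r_1,…,r_s) = θ^{r_1}(u_1) ⋯ θ^{r_s}(u_s)
  I : ∀ {s} → Vec Bool s → R s
  I {zero}  V.[]      = oneR zero
  I {suc s} (r V.∷ T) = mulR (θᵇu₁ r) (inner (I T))

  graySum : ∀ {s} → List (Vec Bool s) → List F → R s
  graySum {s} (T ∷ Ts') (a ∷ as) = addR (mulR (embF a) (I T)) (graySum Ts' as)
  graySum {s} _ _ = zeroR s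

  GrayLen : ℕ → ℕ
  GrayLen s = length (Ts s)

  -- φ(α) = v  (φ given by its graph: α = Σ_i v_i I_i)
  IsGray : ∀ {s} → R s → Vec F (GrayLen s) → Set
  IsGray {s} α v = α ≡ graySum (Ts s) (V.toList v)

  IsGrayWord : ∀ {s n} → Vec (R s) n → Vec (Vec F (GrayLen s)) n → Set
  IsGrayWord c v = ∀ j → IsGray (lookup c j) (lookup v j)

  -- DNA reverse of φ(c) is φ(θ(c_{n-1}),…,θ(c_0))
  θrev : ∀ {s n} → Vec (R s) n → Vec (R s) n
  θrev c = V.map θR (V.reverse c)

  ReversibleDNA : ∀ s n → (Vec (R s) n → Set) → Set
  ReversibleDNA s n C =
    ∀ c → C c → ∃[ c' ] (C c' × ∃[ v ] (IsGrayWord c' v × IsGrayWord (θrev c) v))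

module Submission where

-- Write q = 4^(2k) and R = R_{k,s}. Since q is even and a^q = a in F,
-- F has characteristic 2 and the Frobenius θ(a) = a^(4^k) is an involutive
-- ring automorphism of F, hence of R. Identify a word with a function ℕ → R
-- read at positions < n, and a polynomial with its reduction modulo x^n - 1
-- (which θ fixes). Left multiplication by x becomes the twisted rotation
-- xmul(w)_j = θ(w_{j-1}), the DNA reversal is rev(w)_j = θ(w_{n-1-j}), and for
-- n even one checks
--   rev(a·w) = θ(a)·rev(w),    rev(x·w) = x^(n-1)·rev(w).
-- If g is palindromic of even degree t, then rev(g) = x^m·g for the odd number
-- m = (n-1)(t+1) (odd powers of θ equal θ). By induction on f, rev(f·g) is
-- again a left multiple of g, so the code (g) is closed under DNA reversal.
-- Finally the Gray map is total (every element of R is an F-combination of the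
-- products I_T), so φ of the reversed word exists and serves as the witness.

open import Defs
open import Level using (0ℓ)
open import Data.Nat as ℕ using (ℕ; zero; suc; _^_; _*_; _<_; _∸_; _≤_; s≤s; z≤n)
import Data.Nat.Properties as ℕP
open import Data.Nat.Divisibility using (_∣_; divides)
open import Data.Nat.Tactic.RingSolver using (solve-∀)
open import Data.Fin as Fin using (Fin)
import Data.Fin.Properties as FinP
open import Data.Fin.Permutation using (Permutation; permutation; remove; punchIn-permute; _⟨$⟩ʳ_)
open import Data.Bool using (Bool; true; false)
open import Data.List as L using (List; []; _∷_; _++_)
import Data.List.Properties as LP
open import Data.List.Membership.Propositional using (_∈_)
open import Data.List.Membership.Propositional.Properties using (∈-++⁺ˡ; ∈-++⁺ʳ; ∈-map⁺; ∈-concat⁺′; ∈-upTo⁺)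
open import Data.List.Relation.Unary.Any using (here; there)
open import Data.Vec as V using (Vec)
import Data.Vec.Properties as VP
open import Data.Product using (∃-syntax; _,_; proj₁; proj₂)
open import Data.Sum using (inj₁; inj₂)
open import Data.Empty using (⊥-elim)
open import Relation.Nullary using (Dec; yes; no)
open import Relation.Binary.PropositionalEquality
open import Algebra.Bundles using (CommutativeRing; CommutativeMonoid)
open import Algebra.Structures using (IsCommutativeRing)
open import Function.Bundles using (_↔_; Inverse)
import Algebra.Properties.Ring as RingProperties
import Algebra.Properties.Group as GroupProperties
import Algebra.Properties.CommutativeMonoid.Sum as MonoidSum
import Algebra.Solver.CommutativeMonoid as CMSolver

module FieldFacts (k : ℕ) (k≥1 : 1 ≤ k) (FF : FiniteField (4 ^ (2 * k))) where
  open FiniteField FF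
  open Skew k FF using (F; powF; θF)
  open IsCommutativeRing isCommutativeRing public
    using (+-assoc; +-comm; +-identityˡ; +-identityʳ; -‿inverseˡ; -‿inverseʳ;
           *-assoc; *-comm; *-identityˡ; *-identityʳ; distribˡ; distribʳ; zeroˡ; zeroʳ)
  open ≡-Reasoning

  fieldRing : CommutativeRing 0ℓ 0ℓ
  fieldRing = record { isCommutativeRing = isCommutativeRing }

  module Product = MonoidSum (CommutativeRing.*-commutativeMonoid fieldRing)
  open Product using () renaming (sum to prod)

  cancelʳ : ∀ a b c → c ≢ 0# → a · c ≡ b · c → a ≡ b
  cancelʳ a b c c≢0 ac≡bc with inverse c c≢0
  ... | d , cd≡1 = begin
      a                ≡⟨ sym (*-identityʳ a) ⟩
      a · 1#           ≡⟨ cong (a ·_) (sym cd≡1) ⟩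
      a · (c · d)      ≡⟨ sym (*-assoc a c d) ⟩
      (a · c) · d      ≡⟨ cong (_· d) ac≡bc ⟩
      (b · c) · d      ≡⟨ *-assoc b c d ⟩
      b · (c · d)      ≡⟨ cong (b ·_) cd≡1 ⟩
      b · 1#           ≡⟨ *-identityʳ b ⟩
      b ∎

  ·-nonzero : ∀ a b → a ≢ 0# → b ≢ 0# → a · b ≢ 0#
  ·-nonzero a b a≢0 b≢0 ab≡0 = a≢0 (cancelʳ a 0# b b≢0 (trans ab≡0 (sym (zeroˡ b))))

  prod-nonzero : ∀ m (f : Fin m → F) → (∀ i → f i ≢ 0#) → prod f ≢ 0#
  prod-nonzero zero    f f≢0 1≡0 = 0≢1 (sym 1≡0)
  prod-nonzero (suc m) f f≢0 =
    ·-nonzero _ _ (f≢0 Fin.zero) (prod-nonzero m (λ i → f (Fin.suc i)) (λ i → f≢0 (Fin.suc i)))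

  powF-+ : ∀ a m n → powF a (m ℕ.+ n) ≡ powF a m · powF a n
  powF-+ a zero    n = sym (*-identityˡ _)
  powF-+ a (suc m) n = trans (cong (a ·_) (powF-+ a m n)) (sym (*-assoc _ _ _))

  powF-* : ∀ a m n → powF a (m * n) ≡ powF (powF a m) n
  powF-* a m zero    = cong (powF a) (ℕP.*-zeroʳ m)
  powF-* a m (suc n) = begin
    powF a (m * suc n)           ≡⟨ cong (powF a) (ℕP.*-suc m n) ⟩
    powF a (m ℕ.+ m * n)         ≡⟨ powF-+ a m (m * n) ⟩
    powF a m · powF a (m * n)    ≡⟨ cong (powF a m ·_) (powF-* a m n) ⟩
    powF a m · powF (powF a m) n ∎

  powF-prod : ∀ x n → prod (λ (_ : Fin n) → x) ≡ powF x n
  powF-prod x zero    = refl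
  powF-prod x (suc n) = cong (x ·_) (powF-prod x n)

  prod-scale : ∀ n a (f : Fin n → F) → prod (λ i → a · f i) ≡ powF a n · prod f
  prod-scale n a f = trans (Product.∑-distrib-+ (λ _ → a) f) (cong (_· prod f) (powF-prod a n))

  powF-· : ∀ a b n → powF (a · b) n ≡ powF a n · powF b n
  powF-· a b n = begin
    powF (a · b) n                ≡⟨ sym (powF-prod (a · b) n) ⟩
    prod (λ (_ : Fin n) → a · b)  ≡⟨ prod-scale n a (λ _ → b) ⟩
    powF a n · prod (λ (_ : Fin n) → b) ≡⟨ cong (powF a n ·_) (powF-prod b n) ⟩
    powF a n · powF b n ∎

  powF-1 : ∀ n → powF 1# n ≡ 1#
  powF-1 zero    = refl
  powF-1 (suc n) = trans (*-identityˡ _) (powF-1 n)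

  decEq : ∀ {m} → Fin m ↔ F → (x y : F) → Dec (x ≡ y)
  decEq enum x y with Inverse.from enum x FinP.≟ Inverse.from enum y
  ... | yes p = yes (trans (sym (Inverse.strictlyInverseˡ enum x))
                      (trans (cong (Inverse.to enum) p) (Inverse.strictlyInverseˡ enum y)))
  ... | no ¬p = no (λ x≡y → ¬p (cong (Inverse.from enum) x≡y))

  -- Multiplication by a unit a permutes F and fixes 0, so it permutes the
  -- nonzero elements; comparing their products gives a^(q-1) = 1.
  module UnitPermutation {m : ℕ} (enum : Fin (suc m) ↔ F) (a : F) (a≢0 : a ≢ 0#) where
    private
      to : Fin (suc m) → F
      to = Inverse.to enum
      from : F → Fin (suc m)
      from = Inverse.from enum

    scaleBy : F → Fin (suc m) → Fin (suc m)
    scaleBy x i = from (x · to i)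

    scaleBy-inverse : ∀ x y → x · y ≡ 1# → ∀ i → scaleBy x (scaleBy y i) ≡ i
    scaleBy-inverse x y xy≡1 i = begin
      from (x · to (from (y · to i))) ≡⟨ cong (λ z → from (x · z)) (Inverse.strictlyInverseˡ enum _) ⟩
      from (x · (y · to i))           ≡⟨ cong from (sym (*-assoc x y _)) ⟩
      from ((x · y) · to i)           ≡⟨ cong (λ z → from (z · to i)) xy≡1 ⟩
      from (1# · to i)                ≡⟨ cong from (*-identityˡ _) ⟩
      from (to i)                     ≡⟨ Inverse.strictlyInverseʳ enum i ⟩
      i ∎

    π : Permutation (suc m) (suc m)
    π = permutation (scaleBy a) (scaleBy b) (scaleBy-inverse a b ab≡1) (scaleBy-inverse b a ba≡1)
      where
      b : F
      b = proj₁ (inverse a a≢0)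
      ab≡1 : a · b ≡ 1#
      ab≡1 = proj₂ (inverse a a≢0)
      ba≡1 : b · a ≡ 1#
      ba≡1 = trans (*-comm b a) ab≡1

    zeroIx : Fin (suc m)
    zeroIx = from 0#

    π-fixes-zero : π ⟨$⟩ʳ zeroIx ≡ zeroIx
    π-fixes-zero = cong from (trans (cong (a ·_) (Inverse.strictlyInverseˡ enum 0#)) (zeroʳ a))

    nonzero : Fin m → F
    nonzero j = to (Fin.punchIn zeroIx j)

    nonzero-≢0 : ∀ j → nonzero j ≢ 0#
    nonzero-≢0 j e = FinP.punchInᵢ≢i zeroIx j
      (trans (sym (Inverse.strictlyInverseʳ enum _)) (cong from e))

    π-on-nonzero : ∀ j → nonzero (remove zeroIx π ⟨$⟩ʳ j) ≡ a · nonzero j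
    π-on-nonzero j = begin
      to (Fin.punchIn zeroIx (ρ j))          ≡⟨ cong (λ z → to (Fin.punchIn z (ρ j))) (sym π-fixes-zero) ⟩
      to (Fin.punchIn (π ⟨$⟩ʳ zeroIx) (ρ j)) ≡⟨ cong to (sym (punchIn-permute π zeroIx j)) ⟩
      to (from (a · nonzero j))              ≡⟨ Inverse.strictlyInverseˡ enum _ ⟩
      a · nonzero j ∎
      where
      ρ : Fin m → Fin m
      ρ = remove zeroIx π ⟨$⟩ʳ_

    powF-order-1 : powF a m ≡ 1#
    powF-order-1 = sym (cancelʳ 1# (powF a m) (prod nonzero) (prod-nonzero m nonzero nonzero-≢0) (begin
      1# · prod nonzero                                 ≡⟨ *-identityˡ _ ⟩
      prod nonzero                                      ≡⟨ Product.sum-permute nonzero (remove zeroIx π) ⟩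
      prod (λ j → nonzero (remove zeroIx π ⟨$⟩ʳ j))     ≡⟨ Product.sum-cong-≗ π-on-nonzero ⟩
      prod (λ j → a · nonzero j)                        ≡⟨ prod-scale m a nonzero ⟩
      powF a m · prod nonzero ∎))

  fermat-enum : ∀ m → Fin m ↔ F → ∀ a → powF a m ≡ a
  fermat-enum zero    enum a = ⊥-elim (FinP.¬Fin0 (Inverse.from enum a))
  fermat-enum (suc m) enum a with decEq enum a 0#
  ... | yes refl = zeroˡ _
  ... | no a≢0   = trans (cong (a ·_) (UnitPermutation.powF-order-1 enum a a≢0)) (*-identityʳ a)

  fermat : ∀ a → powF a (4 ^ (2 * k)) ≡ a
  fermat = fermat-enum _ card

  -- Characteristic 2: -1 = (-1)^q = ((-1)²)^(q/2) = 1 because q is even.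
  module _ where
    open RingProperties (CommutativeRing.ring fieldRing) using (-‿distribˡ-*)
    open GroupProperties (CommutativeRing.+-group fieldRing) using (⁻¹-involutive)

    -1²≡1 : (- 1#) · (- 1#) ≡ 1#
    -1²≡1 = begin
      (- 1#) · (- 1#) ≡⟨ sym (-‿distribˡ-* 1# (- 1#)) ⟩
      - (1# · (- 1#)) ≡⟨ cong -_ (*-identityˡ _) ⟩
      - (- 1#)        ≡⟨ ⁻¹-involutive 1# ⟩
      1# ∎

    order-even : 4 ^ (2 * k) ≡ 2 * (2 * 4 ^ (2 * k ∸ 1))
    order-even with 2 * k | ℕP.≤-trans k≥1 (ℕP.m≤n*m k 2)
    ... | suc e | _ = ℕP.*-assoc 2 2 (4 ^ e)

    1+1≡0 : 1# + 1# ≡ 0#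
    1+1≡0 = begin
      1# + 1#     ≡⟨ cong (_+ 1#) 1≡-1 ⟩
      (- 1#) + 1# ≡⟨ -‿inverseˡ 1# ⟩
      0# ∎
      where
      half : ℕ
      half = 2 * 4 ^ (2 * k ∸ 1)
      1≡-1 : 1# ≡ - 1#
      1≡-1 = begin
        1#                           ≡⟨ sym (powF-1 half) ⟩
        powF 1# half                 ≡⟨ cong (λ z → powF z half) (sym -1²≡1) ⟩
        powF ((- 1#) · (- 1#)) half  ≡⟨ cong (λ z → powF ((- 1#) · z) half) (sym (*-identityʳ _)) ⟩
        powF (powF (- 1#) 2) half    ≡⟨ sym (powF-* (- 1#) 2 half) ⟩
        powF (- 1#) (2 * half)       ≡⟨ cong (powF (- 1#)) (sym order-even) ⟩
        powF (- 1#) (4 ^ (2 * k))    ≡⟨ fermat (- 1#) ⟩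
        - 1# ∎

  x+x≡0 : ∀ x → x + x ≡ 0#
  x+x≡0 x = begin
    x + x           ≡⟨ cong₂ _+_ (sym (*-identityʳ x)) (sym (*-identityʳ x)) ⟩
    x · 1# + x · 1# ≡⟨ sym (distribˡ x 1# 1#) ⟩
    x · (1# + 1#)   ≡⟨ cong (x ·_) 1+1≡0 ⟩
    x · 0#          ≡⟨ zeroʳ x ⟩
    0# ∎

  -x≡x : ∀ x → - x ≡ x
  -x≡x x = begin
    - x             ≡⟨ sym (+-identityʳ _) ⟩
    - x + 0#        ≡⟨ cong (- x +_) (sym (x+x≡0 x)) ⟩
    - x + (x + x)   ≡⟨ sym (+-assoc _ _ _) ⟩
    (- x + x) + x   ≡⟨ cong (_+ x) (-‿inverseˡ x) ⟩
    0# + x          ≡⟨ +-identityˡ x ⟩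
    x ∎

  square-+ : ∀ a b → (a + b) · (a + b) ≡ a · a + b · b
  square-+ a b = begin
    (a + b) · (a + b)                 ≡⟨ distribʳ (a + b) a b ⟩
    a · (a + b) + b · (a + b)         ≡⟨ cong₂ _+_ (distribˡ a a b) (distribˡ b a b) ⟩
    (a · a + a · b) + (b · a + b · b) ≡⟨ cong (λ z → (a · a + a · b) + (z + b · b)) (*-comm b a) ⟩
    (a · a + a · b) + (a · b + b · b) ≡⟨ +-assoc _ _ _ ⟩
    a · a + (a · b + (a · b + b · b)) ≡⟨ cong (a · a +_) (sym (+-assoc _ _ _)) ⟩
    a · a + ((a · b + a · b) + b · b) ≡⟨ cong (λ z → a · a + (z + b · b)) (x+x≡0 _) ⟩
    a · a + (0# + b · b)              ≡⟨ cong (a · a +_) (+-identityˡ _) ⟩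
    a · a + b · b ∎

  powF-2^-+ : ∀ e a b → powF (a + b) (2 ^ e) ≡ powF a (2 ^ e) + powF b (2 ^ e)
  powF-2^-+ zero a b = begin
    (a + b) · 1#      ≡⟨ *-identityʳ _ ⟩
    a + b             ≡⟨ sym (cong₂ _+_ (*-identityʳ a) (*-identityʳ b)) ⟩
    a · 1# + b · 1# ∎
  powF-2^-+ (suc e) a b = begin
    powF (a + b) (2 * 2 ^ e)                      ≡⟨ powF-* (a + b) 2 (2 ^ e) ⟩
    powF (powF (a + b) 2) (2 ^ e)                 ≡⟨ cong (λ z → powF z (2 ^ e)) (square a b) ⟩
    powF (a · a + b · b) (2 ^ e)                  ≡⟨ powF-2^-+ e (a · a) (b · b) ⟩
    powF (a · a) (2 ^ e) + powF (b · b) (2 ^ e)    ≡⟨ sym (cong₂ _+_ (square₁ a) (square₁ b)) ⟩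
    powF a (2 * 2 ^ e) + powF b (2 * 2 ^ e) ∎
    where
    square : ∀ x y → powF (x + y) 2 ≡ x · x + y · y
    square x y = trans (cong ((x + y) ·_) (*-identityʳ _)) (square-+ x y)
    square₁ : ∀ x → powF x (2 * 2 ^ e) ≡ powF (x · x) (2 ^ e)
    square₁ x = trans (powF-* x 2 (2 ^ e)) (cong (λ z → powF (x · z) (2 ^ e)) (*-identityʳ x))

  θF-+ : ∀ a b → θF (a + b) ≡ θF a + θF b
  θF-+ a b rewrite ℕP.^-*-assoc 2 2 k = powF-2^-+ (2 * k) a b

  θF-· : ∀ a b → θF (a · b) ≡ θF a · θF b
  θF-· a b = powF-· a b (4 ^ k)

  θF-1 : θF 1# ≡ 1#
  θF-1 = powF-1 (4 ^ k)

  θF-0 : θF 0# ≡ 0#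
  θF-0 with 4 ^ k | ℕP.m^n>0 4 k
  ... | suc e | _ = zeroˡ _

  θF-involutive : ∀ a → θF (θF a) ≡ a
  θF-involutive a = begin
    powF (powF a (4 ^ k)) (4 ^ k)  ≡⟨ sym (powF-* a (4 ^ k) (4 ^ k)) ⟩
    powF a (4 ^ k * 4 ^ k)         ≡⟨ cong (powF a) (sym (ℕP.^-distribˡ-+-* 4 k k)) ⟩
    powF a (4 ^ (k ℕ.+ k))         ≡⟨ cong (λ z → powF a (4 ^ (k ℕ.+ z))) (sym (ℕP.+-identityʳ k)) ⟩
    powF a (4 ^ (2 * k))           ≡⟨ fermat a ⟩
    a ∎

module RingFacts (k : ℕ) (k≥1 : 1 ≤ k) (FF : FiniteField (4 ^ (2 * k))) where
  open FiniteField FF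
  open Skew k FF
  open FieldFacts k k≥1 FF
  open ≡-Reasoning

  +R-assoc : ∀ {s} (x y z : R s) → addR (addR x y) z ≡ addR x (addR y z)
  +R-assoc ⟨ a ⟩ ⟨ b ⟩ ⟨ c ⟩ = cong ⟨_⟩ (+-assoc a b c)
  +R-assoc (a +u b) (c +u d) (e +u f) = cong₂ _+u_ (+R-assoc a c e) (+R-assoc b d f)

  +R-comm : ∀ {s} (x y : R s) → addR x y ≡ addR y x
  +R-comm ⟨ a ⟩ ⟨ b ⟩ = cong ⟨_⟩ (+-comm a b)
  +R-comm (a +u b) (c +u d) = cong₂ _+u_ (+R-comm a c) (+R-comm b d)

  +R-idˡ : ∀ {s} (x : R s) → addR (zeroR s) x ≡ x
  +R-idˡ ⟨ a ⟩ = cong ⟨_⟩ (+-identityˡ a)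
  +R-idˡ (a +u b) = cong₂ _+u_ (+R-idˡ a) (+R-idˡ b)

  +R-idʳ : ∀ {s} (x : R s) → addR x (zeroR s) ≡ x
  +R-idʳ x = trans (+R-comm x _) (+R-idˡ x)

  +R-invʳ : ∀ {s} (x : R s) → addR x (negR x) ≡ zeroR s
  +R-invʳ ⟨ a ⟩ = cong ⟨_⟩ (-‿inverseʳ a)
  +R-invʳ (a +u b) = cong₂ _+u_ (+R-invʳ a) (+R-invʳ b)

  +R-self : ∀ {s} (x : R s) → addR x x ≡ zeroR s
  +R-self ⟨ a ⟩ = cong ⟨_⟩ (x+x≡0 a)
  +R-self (a +u b) = cong₂ _+u_ (+R-self a) (+R-self b)

  negR-id : ∀ {s} (x : R s) → negR x ≡ x
  negR-id ⟨ a ⟩ = cong ⟨_⟩ (-x≡x a)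
  negR-id (a +u b) = cong₂ _+u_ (negR-id a) (negR-id b)

  +R-commutativeMonoid : ℕ → CommutativeMonoid 0ℓ 0ℓ
  +R-commutativeMonoid s = record
    { Carrier = R s ; _≈_ = _≡_ ; _∙_ = addR ; ε = zeroR s
    ; isCommutativeMonoid = record
      { isMonoid = record
        { isSemigroup = record
          { isMagma = record { isEquivalence = isEquivalence ; ∙-cong = cong₂ addR }
          ; assoc = +R-assoc }
        ; identity = +R-idˡ , +R-idʳ }
      ; comm = +R-comm } }

  module +R-Solver (s : ℕ) = CMSolver (+R-commutativeMonoid s)

  interchange : ∀ {s} (a b c d : R s) → addR (addR a b) (addR c d) ≡ addR (addR a c) (addR b d)
  interchange {s} = +R-Solver.solve s 4 (λ a b c d → (a ⊕ b) ⊕ (c ⊕ d) ⊜ (a ⊕ c) ⊕ (b ⊕ d)) refl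
    where open +R-Solver s

  *R-zeroˡ : ∀ {s} (x : R s) → mulR (zeroR s) x ≡ zeroR s
  *R-zeroˡ ⟨ a ⟩ = cong ⟨_⟩ (zeroˡ a)
  *R-zeroˡ {suc s} (a +u b) = cong₂ _+u_ (*R-zeroˡ a)
    (begin
      addR (addR (mulR (zeroR s) b) (mulR (zeroR s) a)) (mulR (zeroR s) b)
        ≡⟨ cong₂ addR (cong₂ addR (*R-zeroˡ b) (*R-zeroˡ a)) (*R-zeroˡ b) ⟩
      addR (addR (zeroR s) (zeroR s)) (zeroR s) ≡⟨ +R-idʳ _ ⟩
      addR (zeroR s) (zeroR s) ≡⟨ +R-idʳ _ ⟩
      zeroR s ∎)

  *R-comm : ∀ {s} (x y : R s) → mulR x y ≡ mulR y x
  *R-comm ⟨ a ⟩ ⟨ b ⟩ = cong ⟨_⟩ (*-comm a b)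
  *R-comm (a +u b) (c +u d) = cong₂ _+u_ (*R-comm a c)
    (begin
      addR (addR (mulR a d) (mulR b c)) (mulR b d)
        ≡⟨ cong₂ addR (+R-comm (mulR a d) (mulR b c)) (*R-comm b d) ⟩
      addR (addR (mulR b c) (mulR a d)) (mulR d b)
        ≡⟨ cong₂ (λ u v → addR (addR u v) (mulR d b)) (*R-comm b c) (*R-comm a d) ⟩
      addR (addR (mulR c b) (mulR d a)) (mulR d b) ∎)

  *R-zeroʳ : ∀ {s} (x : R s) → mulR x (zeroR s) ≡ zeroR s
  *R-zeroʳ x = trans (*R-comm x _) (*R-zeroˡ x)

  *R-distribˡ : ∀ {s} (x y z : R s) → mulR x (addR y z) ≡ addR (mulR x y) (mulR x z)
  *R-distribˡ ⟨ a ⟩ ⟨ b ⟩ ⟨ c ⟩ = cong ⟨_⟩ (distribˡ a b c)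
  *R-distribˡ {suc s} (a +u b) (c +u d) (c' +u d') = cong₂ _+u_ (*R-distribˡ a c c')
    (begin
      addR (addR (mulR a (addR d d')) (mulR b (addR c c'))) (mulR b (addR d d'))
        ≡⟨ cong₂ addR (cong₂ addR (*R-distribˡ a d d') (*R-distribˡ b c c')) (*R-distribˡ b d d') ⟩
      addR (addR (addR (mulR a d) (mulR a d')) (addR (mulR b c) (mulR b c'))) (addR (mulR b d) (mulR b d'))
        ≡⟨ +R-Solver.solve s 6 (λ p p' q q' r r' → ((p ⊕ p') ⊕ (q ⊕ q')) ⊕ (r ⊕ r') ⊜ ((p ⊕ q) ⊕ r) ⊕ ((p' ⊕ q') ⊕ r')) refl
             (mulR a d) (mulR a d') (mulR b c) (mulR b c') (mulR b d) (mulR b d') ⟩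
      addR (addR (addR (mulR a d) (mulR b c)) (mulR b d)) (addR (addR (mulR a d') (mulR b c')) (mulR b d')) ∎)
    where open +R-Solver s

  *R-distribʳ : ∀ {s} (x y z : R s) → mulR (addR y z) x ≡ addR (mulR y x) (mulR z x)
  *R-distribʳ x y z = trans (*R-comm _ x) (trans (*R-distribˡ x y z) (cong₂ addR (*R-comm x y) (*R-comm x z)))

  *R-assoc : ∀ {s} (x y z : R s) → mulR (mulR x y) z ≡ mulR x (mulR y z)
  *R-assoc ⟨ a ⟩ ⟨ b ⟩ ⟨ c ⟩ = cong ⟨_⟩ (*-assoc a b c)
  *R-assoc {suc s} (a +u b) (c +u d) (e +u f) = cong₂ _+u_ (*R-assoc a c e)
    (begin
      addR (addR (mulR (mulR a c) f) (mulR (addR (addR (mulR a d) (mulR b c)) (mulR b d)) e))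
           (mulR (addR (addR (mulR a d) (mulR b c)) (mulR b d)) f)
        ≡⟨ cong₂ (λ u v → addR (addR (mulR (mulR a c) f) u) v) (distribʳ₃ _ _ _ e) (distribʳ₃ _ _ _ f) ⟩
      addR (addR (mulR (mulR a c) f) (addR (addR (mulR (mulR a d) e) (mulR (mulR b c) e)) (mulR (mulR b d) e)))
           (addR (addR (mulR (mulR a d) f) (mulR (mulR b c) f)) (mulR (mulR b d) f))
        ≡⟨ +R-Solver.solve s 7 (λ acf ade bce bde adf bcf bdf →
              (acf ⊕ ((ade ⊕ bce) ⊕ bde)) ⊕ ((adf ⊕ bcf) ⊕ bdf) ⊜
              (((acf ⊕ ade) ⊕ adf) ⊕ bce) ⊕ ((bcf ⊕ bde) ⊕ bdf)) refl _ _ _ _ _ _ _ ⟩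
      addR (addR (addR (addR (mulR (mulR a c) f) (mulR (mulR a d) e)) (mulR (mulR a d) f)) (mulR (mulR b c) e))
           (addR (addR (mulR (mulR b c) f) (mulR (mulR b d) e)) (mulR (mulR b d) f))
        ≡⟨ cong₂ addR
             (cong₂ addR (cong₂ addR (cong₂ addR (*R-assoc a c f) (*R-assoc a d e)) (*R-assoc a d f)) (*R-assoc b c e))
             (cong₂ addR (cong₂ addR (*R-assoc b c f) (*R-assoc b d e)) (*R-assoc b d f)) ⟩
      addR (addR (addR (addR (mulR a (mulR c f)) (mulR a (mulR d e))) (mulR a (mulR d f))) (mulR b (mulR c e)))
           (addR (addR (mulR b (mulR c f)) (mulR b (mulR d e))) (mulR b (mulR d f)))
        ≡⟨ cong₂ addR (cong (λ t → addR t (mulR b (mulR c e))) (sym (distribˡ₃ a _ _ _))) (sym (distribˡ₃ b _ _ _)) ⟩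
      addR (addR (mulR a (addR (addR (mulR c f) (mulR d e)) (mulR d f))) (mulR b (mulR c e)))
           (mulR b (addR (addR (mulR c f) (mulR d e)) (mulR d f))) ∎)
    where
    open +R-Solver s
    distribʳ₃ : ∀ (u v w z : R s) → mulR (addR (addR u v) w) z ≡ addR (addR (mulR u z) (mulR v z)) (mulR w z)
    distribʳ₃ u v w z = trans (*R-distribʳ z _ w) (cong (λ t → addR t (mulR w z)) (*R-distribʳ z u v))
    distribˡ₃ : ∀ (z u v w : R s) → mulR z (addR (addR u v) w) ≡ addR (addR (mulR z u) (mulR z v)) (mulR z w)
    distribˡ₃ z u v w = trans (*R-distribˡ z _ w) (cong (λ t → addR t (mulR z w)) (*R-distribˡ z u v))

  *R-oneˡ : ∀ {s} (x : R s) → mulR (oneR s) x ≡ x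
  *R-oneˡ ⟨ a ⟩ = cong ⟨_⟩ (*-identityˡ a)
  *R-oneˡ {suc s} (a +u b) = cong₂ _+u_ (*R-oneˡ a)
    (begin
      addR (addR (mulR (oneR s) b) (mulR (zeroR s) a)) (mulR (zeroR s) b)
        ≡⟨ cong₂ addR (cong₂ addR (*R-oneˡ b) (*R-zeroˡ a)) (*R-zeroˡ b) ⟩
      addR (addR b (zeroR s)) (zeroR s) ≡⟨ +R-idʳ _ ⟩
      addR b (zeroR s) ≡⟨ +R-idʳ _ ⟩
      b ∎)

  embF-0 : ∀ {s} → embF {s} 0# ≡ zeroR s
  embF-0 {zero} = refl
  embF-0 {suc s} = cong (_+u zeroR s) embF-0

  embF-1 : ∀ {s} → embF {s} 1# ≡ oneR s
  embF-1 {zero} = refl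
  embF-1 {suc s} = cong (_+u zeroR s) embF-1

  embF-+ : ∀ {s} c d → embF {s} (c + d) ≡ addR (embF c) (embF d)
  embF-+ {zero} c d = refl
  embF-+ {suc s} c d = cong₂ _+u_ (embF-+ c d) (sym (+R-idʳ _))

  embF-· : ∀ {s} c d → embF {s} (c · d) ≡ mulR (embF c) (embF d)
  embF-· {zero} c d = refl
  embF-· {suc s} c d = cong₂ _+u_ (embF-· c d)
    (sym (trans (cong₂ addR (cong₂ addR (*R-zeroʳ _) (*R-zeroˡ _)) (*R-zeroˡ _))
          (trans (+R-idʳ _) (+R-idʳ _))))

  θR-0 : ∀ {s} → θR (zeroR s) ≡ zeroR s
  θR-0 {zero} = cong ⟨_⟩ θF-0
  θR-0 {suc s} = cong₂ _+u_ (trans (cong₂ addR θR-0 θR-0) (+R-idʳ _)) θR-0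

  θR-1 : ∀ {s} → θR (oneR s) ≡ oneR s
  θR-1 {zero} = cong ⟨_⟩ θF-1
  θR-1 {suc s} = cong₂ _+u_ (trans (cong₂ addR θR-1 θR-0) (+R-idʳ _)) θR-0

  θR-+ : ∀ {s} (x y : R s) → θR (addR x y) ≡ addR (θR x) (θR y)
  θR-+ ⟨ a ⟩ ⟨ b ⟩ = cong ⟨_⟩ (θF-+ a b)
  θR-+ (a +u b) (c +u d) = cong₂ _+u_
    (trans (cong₂ addR (θR-+ a c) (θR-+ b d)) (interchange _ _ _ _)) (θR-+ b d)

  θR-involutive : ∀ {s} (x : R s) → θR (θR x) ≡ x
  θR-involutive ⟨ a ⟩ = cong ⟨_⟩ (θF-involutive a)
  θR-involutive {suc s} (a +u b) = cong₂ _+u_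
    (begin
      addR (θR (addR (θR a) (θR b))) (θR (θR b)) ≡⟨ cong (λ t → addR t (θR (θR b))) (θR-+ (θR a) (θR b)) ⟩
      addR (addR (θR (θR a)) (θR (θR b))) (θR (θR b)) ≡⟨ cong₂ (λ u v → addR (addR u v) v) (θR-involutive a) (θR-involutive b) ⟩
      addR (addR a b) b ≡⟨ +R-assoc a b b ⟩
      addR a (addR b b) ≡⟨ cong (addR a) (+R-self b) ⟩
      addR a (zeroR s) ≡⟨ +R-idʳ a ⟩
      a ∎)
    (θR-involutive b)

  θR-· : ∀ {s} (x y : R s) → θR (mulR x y) ≡ mulR (θR x) (θR y)
  θR-· ⟨ a ⟩ ⟨ b ⟩ = cong ⟨_⟩ (θF-· a b)
  θR-· {suc s} (a +u b) (c +u d) = cong₂ _+u_ constant-part u-part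
    where
    open +R-Solver s
    A B C D : R s
    A = θR a
    B = θR b
    C = θR c
    D = θR d
    θ-coefficient : θR (addR (addR (mulR a d) (mulR b c)) (mulR b d)) ≡ addR (addR (mulR A D) (mulR B C)) (mulR B D)
    θ-coefficient = trans (θR-+ _ _) (cong₂ addR (trans (θR-+ _ _) (cong₂ addR (θR-· a d) (θR-· b c))) (θR-· b d))
    constant-part : addR (θR (mulR a c)) (θR (addR (addR (mulR a d) (mulR b c)) (mulR b d)))
            ≡ mulR (addR A B) (addR C D)
    constant-part = begin
      addR (θR (mulR a c)) (θR (addR (addR (mulR a d) (mulR b c)) (mulR b d)))
        ≡⟨ cong₂ addR (θR-· a c) θ-coefficient ⟩
      addR (mulR A C) (addR (addR (mulR A D) (mulR B C)) (mulR B D))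
        ≡⟨ solve 4 (λ p q r t → p ⊕ ((q ⊕ r) ⊕ t) ⊜ (p ⊕ q) ⊕ (r ⊕ t)) refl _ _ _ _ ⟩
      addR (addR (mulR A C) (mulR A D)) (addR (mulR B C) (mulR B D))
        ≡⟨ sym (cong₂ addR (*R-distribˡ A C D) (*R-distribˡ B C D)) ⟩
      addR (mulR A (addR C D)) (mulR B (addR C D))
        ≡⟨ sym (*R-distribʳ _ A B) ⟩
      mulR (addR A B) (addR C D) ∎
    u-part : θR (addR (addR (mulR a d) (mulR b c)) (mulR b d))
             ≡ addR (addR (mulR (addR A B) D) (mulR B (addR C D))) (mulR B D)
    u-part = begin
      θR (addR (addR (mulR a d) (mulR b c)) (mulR b d)) ≡⟨ θ-coefficient ⟩
      addR (addR (mulR A D) (mulR B C)) (mulR B D) ≡⟨ sym (+R-idʳ _) ⟩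
      addR (addR (addR (mulR A D) (mulR B C)) (mulR B D)) (zeroR s)
        ≡⟨ cong (addR _) (sym (+R-self (mulR B D))) ⟩
      addR (addR (addR (mulR A D) (mulR B C)) (mulR B D)) (addR (mulR B D) (mulR B D))
        ≡⟨ solve 3 (λ p q r → ((p ⊕ q) ⊕ r) ⊕ (r ⊕ r) ⊜ ((p ⊕ r) ⊕ (q ⊕ r)) ⊕ r) refl _ _ _ ⟩
      addR (addR (addR (mulR A D) (mulR B D)) (addR (mulR B C) (mulR B D))) (mulR B D)
        ≡⟨ cong₂ (λ u v → addR (addR u v) (mulR B D)) (sym (*R-distribʳ D A B)) (sym (*R-distribˡ B C D)) ⟩
      addR (addR (mulR (addR A B) D) (mulR B (addR C D))) (mulR B D) ∎



-- The Gray map is total: every element of R_s is an F-combination of the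
-- products I_T (T ∈ {0,1}^s), and every T occurs in the enumeration Ts s.
module GrayFacts (k : ℕ) (k≥1 : 1 ≤ k) (FF : FiniteField (4 ^ (2 * k))) where
  open FiniteField FF
  open Skew k FF
  open FieldFacts k k≥1 FF
  open RingFacts k k≥1 FF
  open ≡-Reasoning

  InSpan : ∀ {s} → List (Vec Bool s) → R s → Set
  InSpan L x = ∃[ v ] (x ≡ graySum L (V.toList {n = L.length L} v))

  graySum-zero : ∀ {s} (L : List (Vec Bool s)) → graySum L (V.toList (V.replicate (L.length L) 0#)) ≡ zeroR s
  graySum-zero [] = refl
  graySum-zero (T ∷ L) = trans (cong₂ addR (trans (cong (λ z → mulR z (I T)) embF-0) (*R-zeroˡ _)) (graySum-zero L)) (+R-idʳ _)

  graySum-+ : ∀ {s} (L : List (Vec Bool s)) (v w : Vec F (L.length L)) →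
         graySum L (V.toList (V.zipWith _+_ v w)) ≡ addR (graySum L (V.toList v)) (graySum L (V.toList w))
  graySum-+ [] V.[] V.[] = sym (+R-idʳ _)
  graySum-+ (T ∷ L) (a V.∷ v) (b V.∷ w) = begin
    addR (mulR (embF (a + b)) (I T)) (graySum L (V.toList (V.zipWith _+_ v w)))
      ≡⟨ cong₂ addR (trans (cong (λ z → mulR z (I T)) (embF-+ a b)) (*R-distribʳ _ _ _)) (graySum-+ L v w) ⟩
    addR (addR (mulR (embF a) (I T)) (mulR (embF b) (I T))) (addR (graySum L (V.toList v)) (graySum L (V.toList w)))
      ≡⟨ interchange _ _ _ _ ⟩
    addR (addR (mulR (embF a) (I T)) (graySum L (V.toList v))) (addR (mulR (embF b) (I T)) (graySum L (V.toList w))) ∎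

  graySum-scale : ∀ {s} (L : List (Vec Bool s)) c (v : Vec F (L.length L)) →
         graySum L (V.toList (V.map (c ·_) v)) ≡ mulR (embF c) (graySum L (V.toList v))
  graySum-scale [] c V.[] = sym (*R-zeroʳ _)
  graySum-scale (T ∷ L) c (a V.∷ v) = begin
    addR (mulR (embF (c · a)) (I T)) (graySum L (V.toList (V.map (c ·_) v)))
      ≡⟨ cong₂ addR (trans (cong (λ z → mulR z (I T)) (embF-· c a)) (*R-assoc _ _ _)) (graySum-scale L c v) ⟩
    addR (mulR (embF c) (mulR (embF a) (I T))) (mulR (embF c) (graySum L (V.toList v)))
      ≡⟨ sym (*R-distribˡ _ _ _) ⟩
    mulR (embF c) (addR (mulR (embF a) (I T)) (graySum L (V.toList v))) ∎

  I-inSpan : ∀ {s} (L : List (Vec Bool s)) T → T ∈ L → InSpan L (I T)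
  I-inSpan (T' ∷ L) T (here refl) = 1# V.∷ V.replicate (L.length L) 0# ,
    sym (trans (cong₂ addR (trans (cong (λ z → mulR z (I T)) embF-1) (*R-oneˡ _)) (graySum-zero L)) (+R-idʳ _))
  I-inSpan (T' ∷ L) T (there p) with I-inSpan L T p
  ... | v , e = 0# V.∷ v ,
    trans e (sym (trans (cong (λ z → addR z (graySum L (V.toList v)))
       (trans (cong (λ z → mulR z (I T')) embF-0) (*R-zeroˡ _))) (+R-idˡ _)))

  SpanInduction : ℕ → Set₁
  SpanInduction s = ∀ (P : R s → Set) → P (zeroR s) → (∀ x y → P x → P y → P (addR x y)) →
              (∀ c x → P x → P (mulR (embF c) x)) → (∀ T → P (I T)) → ∀ x → P x

  embF-mul-+u : ∀ {s} c (y z : R s) → mulR (embF {suc s} c) (y +u z) ≡ mulR (embF c) y +u mulR (embF c) z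
  embF-mul-+u {s} c y z = cong (mulR (embF c) y +u_)
    (trans (cong₂ addR (cong (addR (mulR (embF c) z)) (*R-zeroˡ y)) (*R-zeroˡ z))
           (trans (+R-idʳ _) (+R-idʳ _)))

  I-true : ∀ {s} (T : Vec Bool s) → I (true V.∷ T) ≡ I T +u I T
  I-true {s} T = cong₂ _+u_
    (trans (cong (λ z → mulR z (I T)) (+R-idˡ (oneR s))) (*R-oneˡ _))
    (begin
      addR (addR (mulR (addR (zeroR s) (oneR s)) (zeroR s)) (mulR (addR (oneR s) (zeroR s)) (I T)))
           (mulR (addR (oneR s) (zeroR s)) (zeroR s))
        ≡⟨ cong₂ addR (cong₂ addR (*R-zeroʳ _) (trans (cong (λ z → mulR z (I T)) (+R-idʳ _)) (*R-oneˡ _))) (*R-zeroʳ _) ⟩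
      addR (addR (zeroR s) (I T)) (zeroR s) ≡⟨ trans (+R-idʳ _) (+R-idˡ _) ⟩
      I T ∎)

  I-false : ∀ {s} (T : Vec Bool s) → I (false V.∷ T) ≡ zeroR s +u I T
  I-false {s} T = cong₂ _+u_ (*R-zeroˡ _)
    (begin
      addR (addR (mulR (zeroR s) (zeroR s)) (mulR (oneR s) (I T))) (mulR (oneR s) (zeroR s))
        ≡⟨ cong₂ addR (cong₂ addR (*R-zeroˡ _) (*R-oneˡ _)) (*R-zeroʳ _) ⟩
      addR (addR (zeroR s) (I T)) (zeroR s) ≡⟨ trans (+R-idʳ _) (+R-idˡ _) ⟩
      I T ∎)

  -- Proof: a + b u = (a + a u) + (b - a) u, and the two summands are handled by
  -- induction on s using I-true and I-false respectively.
  spanInduction : ∀ s → SpanInduction s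
  spanInduction zero P p0 p+ pc pI ⟨ a ⟩ = subst P (cong ⟨_⟩ (*-identityʳ a)) (pc a _ (pI V.[]))
  spanInduction (suc s) P p0 p+ pc pI (a +u b) = subst P split (p+ _ _ Pleft Pright)
    where
    P₁ : R s → Set
    P₁ y = P (y +u y)
    P₂ : R s → Set
    P₂ y = P (zeroR s +u y)
    Pleft : P (a +u a)
    Pleft = spanInduction s P₁ p0 (λ x y px py → p+ _ _ px py)
           (λ c x px → subst P (embF-mul-+u c x x) (pc c _ px))
           (λ T → subst P (I-true T) (pI (true V.∷ T))) a
    diff : R s
    diff = addR (negR a) b
    Pright : P (zeroR s +u diff)
    Pright = spanInduction s P₂ p0 (λ x y px py → subst P (cong (_+u addR x y) (+R-idˡ _)) (p+ _ _ px py))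
           (λ c x px → subst P (trans (embF-mul-+u c (zeroR s) x) (cong (_+u mulR (embF c) x) (*R-zeroʳ _))) (pc c _ px))
           (λ T → subst P (I-false T) (pI (false V.∷ T))) diff
    split : addR (a +u a) (zeroR s +u diff) ≡ a +u b
    split = cong₂ _+u_ (+R-idʳ a)
      (trans (sym (+R-assoc _ _ _)) (trans (cong (λ z → addR z b) (+R-invʳ a)) (+R-idˡ b)))

  ones : ∀ {s} → Vec Bool s → ℕ
  ones V.[] = 0
  ones (true V.∷ T) = suc (ones T)
  ones (false V.∷ T) = ones T

  ones≤ : ∀ {s} (T : Vec Bool s) → ones T ≤ s
  ones≤ V.[] = z≤n
  ones≤ (true V.∷ T) = s≤s (ones≤ T)
  ones≤ (false V.∷ T) = ℕP.m≤n⇒m≤1+n (ones≤ T)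

  ∈-withOnes : ∀ {s} (T : Vec Bool s) → T ∈ withOnes s (ones T)
  ∈-withOnes V.[] = here refl
  ∈-withOnes (true V.∷ T) = ∈-++⁺ˡ (∈-map⁺ (true V.∷_) (∈-withOnes T))
  ∈-withOnes (false V.∷ T) with ones T | ∈-withOnes T
  ... | zero | p = ∈-map⁺ (false V.∷_) p
  ... | suc w | p = ∈-++⁺ʳ (L.map (true V.∷_) (withOnes _ w)) (∈-map⁺ (false V.∷_) p)

  ∈-Ts : ∀ {s} (T : Vec Bool s) → T ∈ Ts s
  ∈-Ts T = ∈-concat⁺′ (∈-withOnes T) (∈-map⁺ (withOnes _) (∈-upTo⁺ (s≤s (ones≤ T))))

  gray : ∀ {s} (x : R s) → ∃[ v ] (IsGray x v)
  gray {s} x = spanInduction s (InSpan (Ts s))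
    (V.replicate _ 0# , sym (graySum-zero (Ts s)))
    (λ x y (v , ex) (w , ey) → V.zipWith _+_ v w , trans (cong₂ addR ex ey) (sym (graySum-+ (Ts s) v w)))
    (λ c x (v , ex) → V.map (c ·_) v , trans (cong (mulR (embF c)) ex) (sym (graySum-scale (Ts s) c v)))
    (λ T → I-inSpan (Ts s) T (∈-Ts T)) x



  grayWord : ∀ {s n} (c : Vec (R s) n) → ∃[ v ] (IsGrayWord c v)
  grayWord c = V.map (λ x → proj₁ (gray x)) c , λ j →
    subst (IsGray (V.lookup c j)) (sym (VP.lookup-map j _ c)) (proj₂ (gray (V.lookup c j)))

-- Words of length n = n'+1 over R_s, represented as functions ℕ → R s that are
-- compared only at positions below n, and the reduction of skew polynomials
-- modulo x^n - 1. Left multiplication by x acts on reduced words as the twisted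
-- rotation xmul, and the DNA reversal of a word is rev.
module CyclicWords (k : ℕ) (k≥1 : 1 ≤ k) (FF : FiniteField (4 ^ (2 * k))) (s n' : ℕ) where
  open FiniteField FF
  open Skew k FF
  open FieldFacts k k≥1 FF
  open RingFacts k k≥1 FF
  open ≡-Reasoning

  n : ℕ
  n = suc n'

  Word : Set
  Word = ℕ → R s

  infix 4 _≐_
  _≐_ : Word → Word → Set
  v ≐ w = ∀ j → j < n → v j ≡ w j

  ≐-trans : ∀ {u v w} → u ≐ v → v ≐ w → u ≐ w
  ≐-trans p q j lt = trans (p j lt) (q j lt)

  ≐-sym : ∀ {u v} → u ≐ v → v ≐ u
  ≐-sym p j lt = sym (p j lt)

  pointwise : ∀ {u v : Word} → (∀ j → u j ≡ v j) → u ≐ v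
  pointwise p j _ = p j

  wzero : Word
  wzero _ = zeroR s

  wadd : Word → Word → Word
  wadd v w j = addR (v j) (w j)

  rot : Word → Word
  rot v zero = v n'
  rot v (suc j) = v j

  -- left multiplication by x modulo x^n - 1, since x·a = θ(a)·x
  xmul : Word → Word
  xmul v j = θR (rot v j)

  rev : Word → Word
  rev v j = θR (v (n' ∸ j))

  -- reduction modulo x^n - 1: coefficients of x^(j + n·i) are added up at j
  reduce : Poly s → Word
  reduce [] _ = zeroR s
  reduce (a ∷ p) zero = addR a (reduce p n')
  reduce (a ∷ p) (suc j) = reduce p j

  rot^ : ℕ → Word → Word
  rot^ zero v = v
  rot^ (suc i) v = rot (rot^ i v)

  xmul^ : ℕ → Word → Word
  xmul^ zero v = v
  xmul^ (suc i) v = xmul (xmul^ i v)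

  rot-pw : ∀ {v w} → (∀ j → v j ≡ w j) → ∀ j → rot v j ≡ rot w j
  rot-pw p zero = p n'
  rot-pw p (suc j) = p j

  xmul-pw : ∀ {v w} → (∀ j → v j ≡ w j) → ∀ j → xmul v j ≡ xmul w j
  xmul-pw p j = cong θR (rot-pw p j)

  rot-resp : ∀ {v w} → v ≐ w → rot v ≐ rot w
  rot-resp p zero _ = p n' (s≤s ℕP.≤-refl)
  rot-resp p (suc j) (s≤s lt) = p j (ℕP.m≤n⇒m≤1+n lt)

  xmul-resp : ∀ {v w} → v ≐ w → xmul v ≐ xmul w
  xmul-resp p j lt = cong θR (rot-resp p j lt)

  rot^-resp : ∀ i {v w} → v ≐ w → rot^ i v ≐ rot^ i w
  rot^-resp zero p = p
  rot^-resp (suc i) p = rot-resp (rot^-resp i p)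

  xmul^-resp : ∀ i {v w} → v ≐ w → xmul^ i v ≐ xmul^ i w
  xmul^-resp zero p = p
  xmul^-resp (suc i) p = xmul-resp (xmul^-resp i p)

  rot^-pw : ∀ i {v w} → (∀ j → v j ≡ w j) → ∀ j → rot^ i v j ≡ rot^ i w j
  rot^-pw zero p = p
  rot^-pw (suc i) p = rot-pw (rot^-pw i p)

  xmul^-pw : ∀ i {v w} → (∀ j → v j ≡ w j) → ∀ j → xmul^ i v j ≡ xmul^ i w j
  xmul^-pw zero p = p
  xmul^-pw (suc i) p = xmul-pw (xmul^-pw i p)

  wadd-resp : ∀ {v v' w w'} → v ≐ v' → w ≐ w' → wadd v w ≐ wadd v' w'
  wadd-resp p q j lt = cong₂ addR (p j lt) (q j lt)

  rev-resp : ∀ {v w} → v ≐ w → rev v ≐ rev w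
  rev-resp p j lt = cong θR (p (n' ∸ j) (s≤s (ℕP.m∸n≤m n' j)))

  xmul-add : ∀ v w j → xmul (wadd v w) j ≡ addR (xmul v j) (xmul w j)
  xmul-add v w zero = θR-+ _ _
  xmul-add v w (suc j) = θR-+ _ _

  xmul-scal : ∀ c v j → xmul (λ i → mulR c (v i)) j ≡ mulR (θR c) (xmul v j)
  xmul-scal c v zero = θR-· _ _
  xmul-scal c v (suc j) = θR-· _ _

  xmul-zero : ∀ j → xmul wzero j ≡ zeroR s
  xmul-zero zero = θR-0
  xmul-zero (suc j) = θR-0

  rot^-add : ∀ a b v j → rot^ (a ℕ.+ b) v j ≡ rot^ a (rot^ b v) j
  rot^-add zero b v j = refl
  rot^-add (suc a) b v j = rot-pw (rot^-add a b v) j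

  rot^-ix : ∀ i w j → rot^ i w (i ℕ.+ j) ≡ w j
  rot^-ix zero w j = refl
  rot^-ix (suc i) w j = rot^-ix i w j

  rot^-wadd : ∀ i v w j → rot^ i (wadd v w) j ≡ addR (rot^ i v j) (rot^ i w j)
  rot^-wadd zero v w j = refl
  rot^-wadd (suc i) v w zero = rot^-wadd i v w n'
  rot^-wadd (suc i) v w (suc j) = rot^-wadd i v w j

  rot^-θ : ∀ i v j → rot^ i (λ x → θR (v x)) j ≡ θR (rot^ i v j)
  rot^-θ zero v j = refl
  rot^-θ (suc i) v zero = rot^-θ i v n'
  rot^-θ (suc i) v (suc j) = rot^-θ i v j

  rot^-rot : ∀ i v j → rot^ i (rot v) j ≡ rot (rot^ i v) j
  rot^-rot i v j = trans (sym (rot^-add i 1 v j)) (cong (λ z → rot^ z v j) (ℕP.+-comm i 1))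

  xmul^-rot : ∀ i v j → xmul^ i v j ≡ θpow i (rot^ i v j)
  xmul^-rot zero v j = refl
  xmul^-rot (suc i) v zero = cong θR (xmul^-rot i v n')
  xmul^-rot (suc i) v (suc j) = cong θR (xmul^-rot i v j)

  xmul^-xmul : ∀ i v j → xmul^ i (xmul v) j ≡ xmul (xmul^ i v) j
  xmul^-xmul zero v j = refl
  xmul^-xmul (suc i) v j = xmul-pw (xmul^-xmul i v) j

  θpow-even : ∀ m (x : R s) → θpow (m * 2) x ≡ x
  θpow-even zero x = refl
  θpow-even (suc m) x = trans (θR-involutive _) (θpow-even m x)

  ∸-suc : ∀ a b → suc b ≤ a → a ∸ b ≡ suc (a ∸ suc b)
  ∸-suc (suc a) zero _ = refl
  ∸-suc (suc a) (suc b) (s≤s le) = ∸-suc a b le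

  rot^-n : ∀ v → rot^ n v ≐ v
  rot^-n v j lt = begin
    rot^ n v j ≡⟨ cong (λ z → rot^ z v j) n≡j+1+d ⟩
    rot^ (j ℕ.+ suc d) v j ≡⟨ rot^-add j (suc d) v j ⟩
    rot^ j (rot^ (suc d) v) j ≡⟨ cong (rot^ j (rot^ (suc d) v)) (sym (ℕP.+-identityʳ j)) ⟩
    rot^ j (rot^ (suc d) v) (j ℕ.+ 0) ≡⟨ rot^-ix j (rot^ (suc d) v) 0 ⟩
    rot^ d v n' ≡⟨ cong (rot^ d v) n'≡d+j ⟩
    rot^ d v (d ℕ.+ j) ≡⟨ rot^-ix d v j ⟩
    v j ∎
    where
    d : ℕ
    d = n' ∸ j
    n'≡d+j : n' ≡ d ℕ.+ j
    n'≡d+j = sym (ℕP.m∸n+n≡m (ℕP.≤-pred lt))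
    n≡j+1+d : n ≡ j ℕ.+ suc d
    n≡j+1+d = trans (cong suc n'≡d+j) (sym (trans (ℕP.+-suc j d) (cong suc (ℕP.+-comm j d))))

  rot^-nK : ∀ K v → rot^ (n * K) v ≐ v
  rot^-nK zero v = pointwise (λ j → cong (λ z → rot^ z v j) (ℕP.*-zeroʳ n))
  rot^-nK (suc K) v = ≐-trans (pointwise (λ j → trans (cong (λ z → rot^ z v j) (ℕP.*-suc n K)) (rot^-add n (n * K) v j)))
                        (≐-trans (rot^-n _) (rot^-nK K v))

  module Even (half : ℕ) (n≡ : n ≡ half * 2) where
    xmul^-n : ∀ v → xmul^ n v ≐ v
    xmul^-n v j lt = trans (xmul^-rot n v j)
      (trans (cong (λ z → θpow z (rot^ n v j)) n≡) (trans (θpow-even half _) (rot^-n v j lt)))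

    xmul-rev-xmul : ∀ w → xmul (rev (xmul w)) ≐ rev w
    xmul-rev-xmul w zero _ = begin
      θR (θR (θR (rot w (n' ∸ n')))) ≡⟨ θR-involutive _ ⟩
      θR (rot w (n' ∸ n')) ≡⟨ cong (λ z → θR (rot w z)) (ℕP.n∸n≡0 n') ⟩
      θR (w n') ∎
    xmul-rev-xmul w (suc j) (s≤s lt) = begin
      θR (θR (θR (rot w (n' ∸ j)))) ≡⟨ θR-involutive _ ⟩
      θR (rot w (n' ∸ j)) ≡⟨ cong (λ z → θR (rot w z)) (∸-suc n' j lt) ⟩
      θR (w (n' ∸ suc j)) ∎

    rev-xmul : ∀ w → rev (xmul w) ≐ xmul^ n' (rev w)
    rev-xmul w = ≐-sym (≐-trans (xmul^-resp n' (≐-sym (xmul-rev-xmul w)))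
                    (≐-trans (pointwise (xmul^-xmul n' _)) (xmul^-n _)))

  reduce-addP : ∀ p q j → reduce (addP p q) j ≡ addR (reduce p j) (reduce q j)
  reduce-addP [] q j = sym (+R-idˡ _)
  reduce-addP (a ∷ p) [] j = sym (+R-idʳ _)
  reduce-addP (a ∷ p) (b ∷ q) zero = trans (cong (addR (addR a b)) (reduce-addP p q n')) (interchange _ _ _ _)
  reduce-addP (a ∷ p) (b ∷ q) (suc j) = reduce-addP p q j

  reduce-map-mul : ∀ c p j → reduce (L.map (mulR c) p) j ≡ mulR c (reduce p j)
  reduce-map-mul c [] j = sym (*R-zeroʳ c)
  reduce-map-mul c (a ∷ p) zero = trans (cong (addR (mulR c a)) (reduce-map-mul c p n')) (sym (*R-distribˡ _ _ _))
  reduce-map-mul c (a ∷ p) (suc j) = reduce-map-mul c p j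

  reduce-map-θ : ∀ p j → reduce (L.map θR p) j ≡ θR (reduce p j)
  reduce-map-θ [] j = sym θR-0
  reduce-map-θ (a ∷ p) zero = trans (cong (addR (θR a)) (reduce-map-θ p n')) (sym (θR-+ _ _))
  reduce-map-θ (a ∷ p) (suc j) = reduce-map-θ p j

  reduce-mulP : ∀ a f g j → reduce (mulP (a ∷ f) g) j ≡ addR (mulR a (reduce g j)) (xmul (reduce (mulP f g)) j)
  reduce-mulP a f g j = trans (reduce-addP (L.map (mulR a) g) _ j) (cong₂ addR (reduce-map-mul a g j) (reduce-x· j))
    where
    reduce-x· : ∀ j → reduce (zeroR s ∷ L.map θR (mulP f g)) j ≡ xmul (reduce (mulP f g)) j
    reduce-x· zero = trans (+R-idˡ _) (reduce-map-θ (mulP f g) n')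
    reduce-x· (suc j) = reduce-map-θ (mulP f g) j

  reduce-++ : ∀ xs ys j → reduce (xs ++ ys) j ≡ addR (reduce xs j) (rot^ (L.length xs) (reduce ys) j)
  reduce-++ [] ys j = sym (+R-idˡ _)
  reduce-++ (a ∷ xs) ys zero = trans (cong (addR a) (reduce-++ xs ys n')) (sym (+R-assoc _ _ _))
  reduce-++ (a ∷ xs) ys (suc j) = reduce-++ xs ys j

  reduce-≈ : ∀ p p' → p ≈P p' → ∀ j → reduce p j ≡ reduce p' j
  reduce-≈ [] [] e j = refl
  reduce-≈ [] (b ∷ p') e zero = sym (trans (cong₂ addR (sym (e 0)) (sym (reduce-≈ [] p' (λ i → e (suc i)) n'))) (+R-idˡ _))
  reduce-≈ [] (b ∷ p') e (suc j) = reduce-≈ [] p' (λ i → e (suc i)) j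
  reduce-≈ (a ∷ p) [] e zero = trans (cong₂ addR (e 0) (reduce-≈ p [] (λ i → e (suc i)) n')) (+R-idˡ _)
  reduce-≈ (a ∷ p) [] e (suc j) = reduce-≈ p [] (λ i → e (suc i)) j
  reduce-≈ (a ∷ p) (b ∷ p') e zero = cong₂ addR (e 0) (reduce-≈ p p' (λ i → e (suc i)) n')
  reduce-≈ (a ∷ p) (b ∷ p') e (suc j) = reduce-≈ p p' (λ i → e (suc i)) j

  coeff-beyond : ∀ (p : Poly s) i → L.length p ≤ i → coeff p i ≡ zeroR s
  coeff-beyond [] i _ = refl
  coeff-beyond (a ∷ p) (suc i) (s≤s le) = coeff-beyond p i le

  reduce-short : ∀ p → L.length p ≤ n → ∀ j → reduce p j ≡ coeff p j
  reduce-short [] _ j = refl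
  reduce-short (a ∷ p) (s≤s le) zero = trans (cong (addR a) (trans (reduce-short p (ℕP.m≤n⇒m≤1+n le) n') (coeff-beyond p n' le))) (+R-idʳ a)
  reduce-short (a ∷ p) (s≤s le) (suc j) = reduce-short p (ℕP.m≤n⇒m≤1+n le) j

  reduce-rep0 : ∀ m j → reduce (L.replicate m (zeroR s)) j ≡ zeroR s
  reduce-rep0 zero j = refl
  reduce-rep0 (suc m) zero = trans (cong (addR (zeroR s)) (reduce-rep0 m n')) (+R-idˡ _)
  reduce-rep0 (suc m) (suc j) = reduce-rep0 m j

  rot-rev-cons : ∀ a p → rot (rev (reduce (a ∷ p))) ≐ wadd (rev (reduce p)) (reduce (θR a ∷ []))
  rot-rev-cons a p zero _ = begin
    θR (reduce (a ∷ p) (n' ∸ n')) ≡⟨ cong (λ z → θR (reduce (a ∷ p) z)) (ℕP.n∸n≡0 n') ⟩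
    θR (addR a (reduce p n')) ≡⟨ θR-+ _ _ ⟩
    addR (θR a) (θR (reduce p n')) ≡⟨ +R-comm _ _ ⟩
    addR (θR (reduce p n')) (θR a) ≡⟨ cong (addR _) (sym (+R-idʳ _)) ⟩
    addR (θR (reduce p n')) (addR (θR a) (zeroR s)) ∎
  rot-rev-cons a p (suc j) (s≤s lt) = begin
    θR (reduce (a ∷ p) (n' ∸ j)) ≡⟨ cong (λ z → θR (reduce (a ∷ p) z)) (∸-suc n' j lt) ⟩
    θR (reduce p (n' ∸ suc j)) ≡⟨ sym (+R-idʳ _) ⟩
    addR (θR (reduce p (n' ∸ suc j))) (zeroR s) ∎

  reduce-reverse : ∀ p → reduce (L.map θR (L.reverse p)) ≐ rot^ (L.length p) (rev (reduce p))
  reduce-reverse [] j lt = sym θR-0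
  reduce-reverse (a ∷ p) = ≐-trans (pointwise reverse-snoc) (≐-trans by-induction (≐-trans rotate-back (pointwise rot^-suc)))
    where
    l : ℕ
    l = L.length p
    xs : Poly s
    xs = L.map θR (L.reverse p)
    length-xs : L.length xs ≡ l
    length-xs = trans (LP.length-map θR (L.reverse p)) (LP.length-reverse p)
    reverse-snoc : ∀ j → reduce (L.map θR (L.reverse (a ∷ p))) j ≡ addR (reduce xs j) (rot^ l (reduce (θR a ∷ [])) j)
    reverse-snoc j = begin
      reduce (L.map θR (L.reverse (a ∷ p))) j ≡⟨ cong (λ z → reduce (L.map θR z) j) (LP.unfold-reverse a p) ⟩
      reduce (L.map θR (L.reverse p ++ a ∷ [])) j ≡⟨ cong (λ z → reduce z j) (LP.map-++ θR (L.reverse p) (a ∷ [])) ⟩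
      reduce (xs ++ θR a ∷ []) j ≡⟨ reduce-++ xs _ j ⟩
      addR (reduce xs j) (rot^ (L.length xs) (reduce (θR a ∷ [])) j) ≡⟨ cong (λ z → addR (reduce xs j) (rot^ z (reduce (θR a ∷ [])) j)) length-xs ⟩
      addR (reduce xs j) (rot^ l (reduce (θR a ∷ [])) j) ∎
    by-induction : (λ j → addR (reduce xs j) (rot^ l (reduce (θR a ∷ [])) j)) ≐ (λ j → addR (rot^ l (rev (reduce p)) j) (rot^ l (reduce (θR a ∷ [])) j))
    by-induction j lt = cong (λ z → addR z (rot^ l (reduce (θR a ∷ [])) j)) (reduce-reverse p j lt)
    rotate-back : (λ j → addR (rot^ l (rev (reduce p)) j) (rot^ l (reduce (θR a ∷ [])) j)) ≐ rot^ l (rot (rev (reduce (a ∷ p))))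
    rotate-back = ≐-trans (pointwise (λ j → sym (rot^-wadd l _ _ j))) (rot^-resp l (≐-sym (rot-rev-cons a p)))
    rot^-suc : ∀ j → rot^ l (rot (rev (reduce (a ∷ p)))) j ≡ rot^ (suc l) (rev (reduce (a ∷ p))) j
    rot^-suc = rot^-rot l _

  coeff-addP : ∀ (p q : Poly s) i → coeff (addP p q) i ≡ addR (coeff p i) (coeff q i)
  coeff-addP [] q i = sym (+R-idˡ _)
  coeff-addP (a ∷ p) [] i = sym (+R-idʳ _)
  coeff-addP (a ∷ p) (b ∷ q) zero = refl
  coeff-addP (a ∷ p) (b ∷ q) (suc i) = coeff-addP p q i

  coeff-map : ∀ (f : R s → R s) → f (zeroR s) ≡ zeroR s → ∀ p i → coeff (L.map f p) i ≡ f (coeff p i)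
  coeff-map f f0 [] i = sym f0
  coeff-map f f0 (a ∷ p) zero = refl
  coeff-map f f0 (a ∷ p) (suc i) = coeff-map f f0 p i

  coeff-++-< : ∀ (xs ys : Poly s) i → i < L.length xs → coeff (xs ++ ys) i ≡ coeff xs i
  coeff-++-< (x ∷ xs) ys zero    _        = refl
  coeff-++-< (x ∷ xs) ys (suc i) (s≤s lt) = coeff-++-< xs ys i lt

  coeff-++-length : ∀ (xs ys : Poly s) → coeff (xs ++ ys) (L.length xs) ≡ coeff ys 0
  coeff-++-length []       ys = refl
  coeff-++-length (x ∷ xs) ys = coeff-++-length xs ys

  coeff-reverse : ∀ (xs : Poly s) l → L.length xs ≡ suc l → ∀ i → i ≤ l →
                  coeff (L.reverse xs) i ≡ coeff xs (l ∸ i)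
  coeff-reverse (a ∷ xs) l len i i≤l
    rewrite LP.unfold-reverse a xs with ℕP.m≤n⇒m<n∨m≡n i≤l
  ... | inj₁ i<l = begin
    coeff (L.reverse xs ++ a ∷ []) i ≡⟨ coeff-++-< (L.reverse xs) _ i (subst (i <_) (sym length-rev) i<l) ⟩
    coeff (L.reverse xs) i           ≡⟨ shorter l i<l (ℕP.suc-injective len) ⟩
    coeff (a ∷ xs) (l ∸ i) ∎
    where
    length-rev : L.length (L.reverse xs) ≡ l
    length-rev = trans (LP.length-reverse xs) (ℕP.suc-injective len)
    shorter : ∀ l → i < l → L.length xs ≡ l → coeff (L.reverse xs) i ≡ coeff (a ∷ xs) (l ∸ i)
    shorter (suc l′) i<l len′ = trans (coeff-reverse xs l′ len′ i (ℕP.≤-pred i<l))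
                                    (cong (coeff (a ∷ xs)) (sym (∸-suc (suc l′) i i<l)))
  ... | inj₂ refl = begin
    coeff (L.reverse xs ++ a ∷ []) i ≡⟨ cong (coeff (L.reverse xs ++ a ∷ [])) (sym length-rev) ⟩
    coeff (L.reverse xs ++ a ∷ []) (L.length (L.reverse xs)) ≡⟨ coeff-++-length (L.reverse xs) _ ⟩
    a                                ≡⟨ cong (coeff (a ∷ xs)) (sym (ℕP.n∸n≡0 i)) ⟩
    coeff (a ∷ xs) (i ∸ i) ∎
    where
    length-rev : L.length (L.reverse xs) ≡ i
    length-rev = trans (LP.length-reverse xs) (ℕP.suc-injective len)

  coeff-x· : Poly s → ℕ → R s
  coeff-x· p zero = zeroR s
  coeff-x· p (suc i) = θR (coeff p i)

  coeff-mulP : ∀ a f h i → coeff (mulP (a ∷ f) h) i ≡ addR (mulR a (coeff h i)) (coeff-x· (mulP f h) i)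
  coeff-mulP a f h i = trans (coeff-addP (L.map (mulR a) h) _ i)
    (cong₂ addR (coeff-map (mulR a) (*R-zeroʳ a) h i) (coeff-x·-mulP i))
    where
    coeff-x·-mulP : ∀ i → coeff (zeroR s ∷ L.map θR (mulP f h)) i ≡ coeff-x· (mulP f h) i
    coeff-x·-mulP zero = refl
    coeff-x·-mulP (suc i) = coeff-map θR θR-0 (mulP f h) i

  mulP-congʳ : ∀ f {h h' : Poly s} → h ≈P h' → mulP f h ≈P mulP f h'
  mulP-congʳ [] e i = refl
  mulP-congʳ (a ∷ f) {h} {h'} e i = trans (coeff-mulP a f h i)
    (trans (cong₂ addR (cong (mulR a) (e i)) (coeff-x·-cong i)) (sym (coeff-mulP a f h' i)))
    where
    coeff-x·-cong : ∀ i → coeff-x· (mulP f h) i ≡ coeff-x· (mulP f h') i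
    coeff-x·-cong zero = refl
    coeff-x·-cong (suc i) = cong θR (mulP-congʳ f e i)

  θ-mulP : ∀ f h → L.map θR (mulP f h) ≈P mulP (L.map θR f) (L.map θR h)
  θ-mulP [] h i = refl
  θ-mulP (a ∷ f) h i = begin
    coeff (L.map θR (mulP (a ∷ f) h)) i ≡⟨ coeff-map θR θR-0 (mulP (a ∷ f) h) i ⟩
    θR (coeff (mulP (a ∷ f) h) i) ≡⟨ cong θR (coeff-mulP a f h i) ⟩
    θR (addR (mulR a (coeff h i)) (coeff-x· (mulP f h) i)) ≡⟨ θR-+ _ _ ⟩
    addR (θR (mulR a (coeff h i))) (θR (coeff-x· (mulP f h) i))
      ≡⟨ cong₂ addR (trans (θR-· _ _) (cong (mulR (θR a)) (sym (coeff-map θR θR-0 h i)))) (θ-coeff-x· i) ⟩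
    addR (mulR (θR a) (coeff (L.map θR h) i)) (coeff-x· (mulP (L.map θR f) (L.map θR h)) i)
      ≡⟨ sym (coeff-mulP (θR a) (L.map θR f) (L.map θR h) i) ⟩
    coeff (mulP (L.map θR (a ∷ f)) (L.map θR h)) i ∎
    where
    θ-coeff-x· : ∀ i → θR (coeff-x· (mulP f h) i) ≡ coeff-x· (mulP (L.map θR f) (L.map θR h)) i
    θ-coeff-x· zero = θR-0
    θ-coeff-x· (suc i) = cong θR (trans (sym (coeff-map θR θR-0 (mulP f h) i)) (θ-mulP f h i))

  tabulateP : (ℕ → R s) → ℕ → Poly s
  tabulateP f zero = []
  tabulateP f (suc m) = f 0 ∷ tabulateP (λ i → f (suc i)) m

  coeff-tab-< : ∀ f m i → i < m → coeff (tabulateP f m) i ≡ f i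
  coeff-tab-< f (suc m) zero _ = refl
  coeff-tab-< f (suc m) (suc i) (s≤s lt) = coeff-tab-< (λ i → f (suc i)) m i lt

  coeff-tab-≥ : ∀ f m i → m ≤ i → coeff (tabulateP f m) i ≡ zeroR s
  coeff-tab-≥ f zero i _ = refl
  coeff-tab-≥ f (suc m) (suc i) (s≤s le) = coeff-tab-≥ (λ i → f (suc i)) m i le

  length-tab : ∀ f m → L.length (tabulateP f m) ≡ m
  length-tab f zero = refl
  length-tab f (suc m) = cong suc (length-tab _ m)

  tabulateP-snoc : ∀ f m → tabulateP f (suc m) ≡ tabulateP f m ++ f m ∷ []
  tabulateP-snoc f zero = refl
  tabulateP-snoc f (suc m) = cong (f 0 ∷_) (tabulateP-snoc (λ i → f (suc i)) m)

  tabulateP-cong : ∀ f h m → (∀ i → i < m → f i ≡ h i) → tabulateP f m ≡ tabulateP h m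
  tabulateP-cong f h zero e = refl
  tabulateP-cong f h (suc m) e = cong₂ _∷_ (e 0 (s≤s z≤n)) (tabulateP-cong _ _ m (λ i lt → e (suc i) (s≤s lt)))

  reverse-tab : ∀ f m → L.reverse (tabulateP f (suc m)) ≡ tabulateP (λ i → f (m ∸ i)) (suc m)
  reverse-tab f zero = refl
  reverse-tab f (suc m) = begin
    L.reverse (tabulateP f (suc (suc m))) ≡⟨ cong L.reverse (tabulateP-snoc f (suc m)) ⟩
    L.reverse (tabulateP f (suc m) ++ f (suc m) ∷ []) ≡⟨ LP.reverse-++ (tabulateP f (suc m)) (f (suc m) ∷ []) ⟩
    f (suc m) ∷ L.reverse (tabulateP f (suc m)) ≡⟨ cong (f (suc m) ∷_) (reverse-tab f m) ⟩
    f (suc m) ∷ tabulateP (λ i → f (m ∸ i)) (suc m) ∎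

  monomial : ℕ → Poly s
  monomial m = L.replicate m (zeroR s) ++ oneR s ∷ []

  modulus : Poly s
  modulus = xⁿ-1 s n

  coeff-modulus-0 : coeff modulus 0 ≡ oneR s
  coeff-modulus-0 = trans (+R-idˡ _) (negR-id _)

  coeff-modulus-suc : ∀ i → coeff modulus (suc i) ≡ coeff (monomial n') i
  coeff-modulus-suc i = trans (coeff-addP (monomial n) (negR (oneR s) ∷ []) (suc i)) (+R-idʳ _)

  coeff-snoc : ∀ (xs : Poly s) c i → coeff (xs ++ c ∷ []) i ≡
             addR (mulR c (coeff (monomial (L.length xs)) i)) (coeff xs i)
  coeff-snoc [] c zero = sym (trans (+R-idʳ _) (trans (*R-comm _ _) (*R-oneˡ c)))
  coeff-snoc [] c (suc i) = sym (trans (+R-idʳ _) (*R-zeroʳ c))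
  coeff-snoc (x ∷ xs) c zero = sym (trans (cong (λ z → addR z x) (*R-zeroʳ c)) (+R-idˡ x))
  coeff-snoc (x ∷ xs) c (suc i) = coeff-snoc xs c i

  map-θ-monomial : ∀ m → L.map θR (monomial m) ≡ monomial m
  map-θ-monomial zero = cong (_∷ []) θR-1
  map-θ-monomial (suc m) = cong₂ _∷_ θR-0 (map-θ-monomial m)

  θ-modulus : L.map θR modulus ≈P modulus
  θ-modulus i = begin
    coeff (L.map θR modulus) i ≡⟨ coeff-map θR θR-0 modulus i ⟩
    θR (coeff modulus i) ≡⟨ cong θR (coeff-addP (monomial n) (negR (oneR s) ∷ []) i) ⟩
    θR (addR (coeff (monomial n) i) (coeff (negR (oneR s) ∷ []) i)) ≡⟨ θR-+ _ _ ⟩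
    addR (θR (coeff (monomial n) i)) (θR (coeff (negR (oneR s) ∷ []) i))
      ≡⟨ cong₂ addR (trans (sym (coeff-map θR θR-0 (monomial n) i)) (cong (λ z → coeff z i) (map-θ-monomial n))) (θ-fixes-1 i) ⟩
    addR (coeff (monomial n) i) (coeff (negR (oneR s) ∷ []) i) ≡⟨ sym (coeff-addP (monomial n) (negR (oneR s) ∷ []) i) ⟩
    coeff modulus i ∎
    where
    θ-fixes-1 : ∀ i → θR (coeff (negR (oneR s) ∷ []) i) ≡ coeff (negR (oneR s) ∷ []) i
    θ-fixes-1 zero = trans (cong θR (negR-id _)) (trans θR-1 (sym (negR-id _)))
    θ-fixes-1 (suc i) = θR-0

  reduce-modulus : reduce modulus ≐ wzero
  reduce-modulus j lt = begin
    reduce modulus j                                            ≡⟨ reduce-addP (monomial n) (minusOne ∷ []) j ⟩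
    addR (reduce (monomial n) j) (reduce (minusOne ∷ []) j)          ≡⟨ cong (λ z → addR z (reduce (minusOne ∷ []) j)) (reduce-++ zeros (oneR s ∷ []) j) ⟩
    addR (addR (reduce zeros j) (rot^ (L.length zeros) (reduce (oneR s ∷ [])) j)) (reduce (minusOne ∷ []) j)
      ≡⟨ cong₂ (λ u v → addR (addR u (rot^ v (reduce (oneR s ∷ [])) j)) (reduce (minusOne ∷ []) j)) (reduce-rep0 n j) (LP.length-replicate n) ⟩
    addR (addR (zeroR s) (rot^ n (reduce (oneR s ∷ [])) j)) (reduce (minusOne ∷ []) j)
      ≡⟨ cong₂ addR (trans (+R-idˡ _) (rot^-n _ j lt)) (cong (λ z → reduce (z ∷ []) j) (negR-id _)) ⟩
    addR (reduce (oneR s ∷ []) j) (reduce (oneR s ∷ []) j)     ≡⟨ +R-self _ ⟩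
    zeroR s ∎
    where
    zeros : Poly s
    zeros = L.replicate n (zeroR s)
    minusOne : R s
    minusOne = negR (oneR s)

  reduce-mul-modulus : ∀ q → reduce (mulP q modulus) ≐ wzero
  reduce-mul-modulus []      j _  = refl
  reduce-mul-modulus (a ∷ q) j lt = begin
    reduce (mulP (a ∷ q) modulus) j                                  ≡⟨ reduce-mulP a q modulus j ⟩
    addR (mulR a (reduce modulus j)) (xmul (reduce (mulP q modulus)) j)
      ≡⟨ cong₂ addR (trans (cong (mulR a) (reduce-modulus j lt)) (*R-zeroʳ a))
                    (trans (xmul-resp (reduce-mul-modulus q) j lt) (xmul-zero j)) ⟩
    addR (zeroR s) (zeroR s)                                         ≡⟨ +R-idˡ _ ⟩
    zeroR s ∎

  map-θ-involutive : ∀ (Q : Poly s) → L.map θR (L.map θR Q) ≡ Q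
  map-θ-involutive [] = refl
  map-θ-involutive (a ∷ Q) = cong₂ _∷_ (θR-involutive a) (map-θ-involutive Q)

  coeff-tab-zero : ∀ m i → coeff (tabulateP (λ _ → zeroR s) m) i ≡ zeroR s
  coeff-tab-zero zero i = refl
  coeff-tab-zero (suc m) zero = refl
  coeff-tab-zero (suc m) (suc i) = coeff-tab-zero m i

  θ-twisted-mul-modulus : ∀ Q' i → θR (coeff (mulP (L.map θR Q') modulus) i) ≡ coeff (mulP Q' modulus) i
  θ-twisted-mul-modulus Q' i = begin
    θR (coeff (mulP (L.map θR Q') modulus) i) ≡⟨ sym (coeff-map θR θR-0 (mulP (L.map θR Q') modulus) i) ⟩
    coeff (L.map θR (mulP (L.map θR Q') modulus)) i ≡⟨ θ-mulP (L.map θR Q') modulus i ⟩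
    coeff (mulP (L.map θR (L.map θR Q')) (L.map θR modulus)) i ≡⟨ cong (λ z → coeff (mulP z (L.map θR modulus)) i) (map-θ-involutive Q') ⟩
    coeff (mulP Q' (L.map θR modulus)) i ≡⟨ mulP-congʳ Q' θ-modulus i ⟩
    coeff (mulP Q' modulus) i ∎

  -- One division step: if p = Q'·(x^n - 1) + r with r the truncated reduction v
  -- of p, then a + x·p = (v_{n-1} + x·θ(Q'))·(x^n - 1) + r', since x·r wraps its
  -- top coefficient v_{n-1}·x^n around, and x·Q' = θ(Q')·x.
  module DivisionStep (a : R s) (p Q' : Poly s) where
    v w : Word
    v = reduce p
    w = reduce (a ∷ p)
    c : R s
    c = v n'
    Q : Poly s
    Q = c ∷ L.map θR Q'

    remainder-head : coeff (addP (mulP Q modulus) (tabulateP w n)) 0 ≡ a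
    remainder-head = begin
      coeff (addP (mulP Q modulus) (tabulateP w n)) 0  ≡⟨ coeff-addP (mulP Q modulus) (tabulateP w n) 0 ⟩
      addR (coeff (mulP Q modulus) 0) (w 0)            ≡⟨ cong (λ z → addR z (w 0)) (coeff-mulP c (L.map θR Q') modulus 0) ⟩
      addR (addR (mulR c (coeff modulus 0)) (zeroR s)) (addR a c)
        ≡⟨ cong (λ z → addR (addR (mulR c z) (zeroR s)) (addR a c)) coeff-modulus-0 ⟩
      addR (addR (mulR c (oneR s)) (zeroR s)) (addR a c)
        ≡⟨ cong (λ z → addR z (addR a c)) (trans (+R-idʳ _) (trans (*R-comm _ _) (*R-oneˡ c))) ⟩
      addR c (addR a c)  ≡⟨ cong (addR c) (+R-comm a c) ⟩
      addR c (addR c a)  ≡⟨ sym (+R-assoc c c a) ⟩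
      addR (addR c c) a  ≡⟨ cong (λ z → addR z a) (+R-self c) ⟩
      addR (zeroR s) a   ≡⟨ +R-idˡ a ⟩
      a ∎

    remainder-tail : p ≈P addP (mulP Q' modulus) (tabulateP v n) →
                     ∀ i → coeff p i ≡ coeff (addP (mulP Q modulus) (tabulateP w n)) (suc i)
    remainder-tail p≈ i = begin
      coeff p i                                                  ≡⟨ p≈ i ⟩
      coeff (addP (mulP Q' modulus) (tabulateP v n)) i           ≡⟨ coeff-addP (mulP Q' modulus) (tabulateP v n) i ⟩
      addR (coeff (mulP Q' modulus) i) (coeff (tabulateP v n) i) ≡⟨ cong (addR (coeff (mulP Q' modulus) i)) top-wraps ⟩
      addR (coeff (mulP Q' modulus) i) (addR (mulR c (coeff (monomial n') i)) (coeff (tabulateP v n') i))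
        ≡⟨ sym (+R-assoc _ _ _) ⟩
      addR (addR (coeff (mulP Q' modulus) i) (mulR c (coeff (monomial n') i))) (coeff (tabulateP v n') i)
        ≡⟨ cong (λ z → addR z (coeff (tabulateP v n') i)) (+R-comm _ _) ⟩
      addR (addR (mulR c (coeff (monomial n') i)) (coeff (mulP Q' modulus) i)) (coeff (tabulateP v n') i)
        ≡⟨ cong₂ (λ z y → addR (addR (mulR c z) y) (coeff (tabulateP v n') i)) (sym (coeff-modulus-suc i)) (sym (θ-twisted-mul-modulus Q' i)) ⟩
      addR (addR (mulR c (coeff modulus (suc i))) (coeff-x· (mulP (L.map θR Q') modulus) (suc i))) (coeff (tabulateP w n) (suc i))
        ≡⟨ cong (λ z → addR z (coeff (tabulateP w n) (suc i))) (sym (coeff-mulP c (L.map θR Q') modulus (suc i))) ⟩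
      addR (coeff (mulP Q modulus) (suc i)) (coeff (tabulateP w n) (suc i))
        ≡⟨ sym (coeff-addP (mulP Q modulus) (tabulateP w n) (suc i)) ⟩
      coeff (addP (mulP Q modulus) (tabulateP w n)) (suc i) ∎
      where
      top-wraps : coeff (tabulateP v n) i ≡ addR (mulR c (coeff (monomial n') i)) (coeff (tabulateP v n') i)
      top-wraps = begin
        coeff (tabulateP v n) i                ≡⟨ cong (λ z → coeff z i) (tabulateP-snoc v n') ⟩
        coeff (tabulateP v n' ++ c ∷ []) i     ≡⟨ coeff-snoc (tabulateP v n') c i ⟩
        addR (mulR c (coeff (monomial (L.length (tabulateP v n'))) i)) (coeff (tabulateP v n') i)
          ≡⟨ cong (λ z → addR (mulR c (coeff (monomial z) i)) (coeff (tabulateP v n') i)) (length-tab v n') ⟩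
        addR (mulR c (coeff (monomial n') i)) (coeff (tabulateP v n') i) ∎

  divide : ∀ p → ∃[ Q ] (p ≈P addP (mulP Q modulus) (tabulateP (reduce p) n))
  divide []      = [] , λ i → sym (coeff-tab-zero n i)
  divide (a ∷ p) with divide p
  ... | Q' , p≈ = Q , λ { zero → sym remainder-head ; (suc i) → remainder-tail p≈ i }
    where open DivisionStep a p Q'

module Multiples (k : ℕ) (k≥1 : 1 ≤ k) (FF : FiniteField (4 ^ (2 * k))) (s n' : ℕ) (g : Skew.Poly k FF s) where
  open FiniteField FF
  open Skew k FF
  open RingFacts k k≥1 FF
  open CyclicWords k k≥1 FF s n'
  open ≡-Reasoning

  Multiple : Word → Set
  Multiple v = ∃[ f ] (reduce (mulP f g) ≐ v)

  Multiple-resp : ∀ {v w} → Multiple v → v ≐ w → Multiple w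
  Multiple-resp (f , e) v≐w = f , ≐-trans e v≐w

  Multiple-0 : Multiple wzero
  Multiple-0 = [] , λ j _ → refl

  Multiple-g : Multiple (reduce g)
  Multiple-g = (oneR s ∷ []) , pointwise (λ j → trans (reduce-mulP (oneR s) [] g j)
    (trans (cong₂ addR (*R-oneˡ _) (xmul-zero j)) (+R-idʳ _)))

  reduce-mulP-addP : ∀ f f' j → reduce (mulP (addP f f') g) j ≡ addR (reduce (mulP f g) j) (reduce (mulP f' g) j)
  reduce-mulP-addP []      f'       j = sym (+R-idˡ _)
  reduce-mulP-addP (a ∷ f) []       j = sym (+R-idʳ _)
  reduce-mulP-addP (a ∷ f) (b ∷ f') j = begin
    reduce (mulP (addR a b ∷ addP f f') g) j ≡⟨ reduce-mulP (addR a b) (addP f f') g j ⟩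
    addR (mulR (addR a b) (reduce g j)) (xmul (reduce (mulP (addP f f') g)) j)
      ≡⟨ cong₂ addR (*R-distribʳ _ a b) (trans (xmul-pw (reduce-mulP-addP f f') j) (xmul-add _ _ j)) ⟩
    addR (addR (mulR a (reduce g j)) (mulR b (reduce g j))) (addR (xmul (reduce (mulP f g)) j) (xmul (reduce (mulP f' g)) j))
      ≡⟨ interchange _ _ _ _ ⟩
    addR (addR (mulR a (reduce g j)) (xmul (reduce (mulP f g)) j)) (addR (mulR b (reduce g j)) (xmul (reduce (mulP f' g)) j))
      ≡⟨ sym (cong₂ addR (reduce-mulP a f g j) (reduce-mulP b f' g j)) ⟩
    addR (reduce (mulP (a ∷ f) g) j) (reduce (mulP (b ∷ f') g) j) ∎

  Multiple-add : ∀ {v w} → Multiple v → Multiple w → Multiple (wadd v w)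
  Multiple-add (f , e) (f' , e') = addP f f' , ≐-trans (pointwise (reduce-mulP-addP f f')) (wadd-resp e e')

  -- the skew product c·f: c·(b + x f) = c b + x (θ(c) f)
  constMul : R s → Poly s → Poly s
  constMul c []      = []
  constMul c (b ∷ f) = mulR c b ∷ constMul (θR c) f

  reduce-constMul : ∀ c f j → reduce (mulP (constMul c f) g) j ≡ mulR c (reduce (mulP f g) j)
  reduce-constMul c []      j = sym (*R-zeroʳ c)
  reduce-constMul c (b ∷ f) j = begin
    reduce (mulP (mulR c b ∷ constMul (θR c) f) g) j ≡⟨ reduce-mulP (mulR c b) (constMul (θR c) f) g j ⟩
    addR (mulR (mulR c b) (reduce g j)) (xmul (reduce (mulP (constMul (θR c) f) g)) j)
      ≡⟨ cong₂ addR (*R-assoc c b _) (trans (xmul-pw (reduce-constMul (θR c) f) j) (xmul-scal (θR c) _ j)) ⟩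
    addR (mulR c (mulR b (reduce g j))) (mulR (θR (θR c)) (xmul (reduce (mulP f g)) j))
      ≡⟨ cong (λ z → addR (mulR c (mulR b (reduce g j))) (mulR z (xmul (reduce (mulP f g)) j))) (θR-involutive c) ⟩
    addR (mulR c (mulR b (reduce g j))) (mulR c (xmul (reduce (mulP f g)) j)) ≡⟨ sym (*R-distribˡ c _ _) ⟩
    mulR c (addR (mulR b (reduce g j)) (xmul (reduce (mulP f g)) j))         ≡⟨ cong (mulR c) (sym (reduce-mulP b f g j)) ⟩
    mulR c (reduce (mulP (b ∷ f) g) j) ∎

  Multiple-scale : ∀ c {v} → Multiple v → Multiple (λ i → mulR c (v i))
  Multiple-scale c (f , e) = constMul c f , λ j lt → trans (reduce-constMul c f j) (cong (mulR c) (e j lt))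

  Multiple-xmul : ∀ {v} → Multiple v → Multiple (xmul v)
  Multiple-xmul (f , e) = (zeroR s ∷ f) , ≐-trans (pointwise (λ j → trans (reduce-mulP (zeroR s) f g j)
    (trans (cong (λ z → addR z (xmul (reduce (mulP f g)) j)) (*R-zeroˡ _)) (+R-idˡ _)))) (xmul-resp e)

  Multiple-xmul^ : ∀ i {v} → Multiple v → Multiple (xmul^ i v)
  Multiple-xmul^ zero    m = m
  Multiple-xmul^ (suc i) m = Multiple-xmul (Multiple-xmul^ i m)

  -- For n even: if rev(g) = x^m·g, then the multiples are closed under rev,
  -- by induction on f using rev(a·g + x·w) = θ(a)·rev(g) + x^(n-1)·rev(w).
  module ReversalClosed (half : ℕ) (n≡ : n ≡ half * 2) (m : ℕ) (rev-g : rev (reduce g) ≐ xmul^ m (reduce g)) where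
    open Even half n≡

    Multiple-rev-mulP : ∀ f → Multiple (rev (reduce (mulP f g)))
    Multiple-rev-mulP []      = Multiple-resp Multiple-0 (λ j _ → sym θR-0)
    Multiple-rev-mulP (a ∷ f) = Multiple-resp
      (Multiple-add (Multiple-scale (θR a) (Multiple-xmul^ m Multiple-g)) (Multiple-xmul^ n' (Multiple-rev-mulP f)))
      (≐-sym (≐-trans (pointwise rev-split) (wadd-resp (λ j lt → cong (mulR (θR a)) (rev-g j lt)) (rev-xmul _))))
      where
      rev-split : ∀ j → rev (reduce (mulP (a ∷ f) g)) j ≡ addR (mulR (θR a) (rev (reduce g) j)) (rev (xmul (reduce (mulP f g))) j)
      rev-split j = trans (cong θR (reduce-mulP a f g (n' ∸ j))) (trans (θR-+ _ _) (cong (λ z → addR z _) (θR-· _ _)))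

    Multiple-rev : ∀ {v} → Multiple v → Multiple (rev v)
    Multiple-rev (f , e) = Multiple-resp (Multiple-rev-mulP f) (rev-resp e)

-- n(t+1) = m + (t+1) for n = 2(q+1), t = 2p and the odd number
-- m = 2(2qp + q + p) + 1 = (n-1)(t+1).
period-split : ∀ q p → (suc q * 2) * suc (p * 2) ≡ suc ((q * p * 2 ℕ.+ q ℕ.+ p) * 2) ℕ.+ suc (p * 2)
period-split = solve-∀

-- The coefficient list of g is its own reverse, so reversal of
-- θ(g) gives rot^(t+1)(rev g); as rot^(n(t+1)) is trivial, rev g = rot^m θ(g),
-- which is x^m·g because θ^m = θ for m odd.
module PalindromicReversal (k : ℕ) (k≥1 : 1 ≤ k) (FF : FiniteField (4 ^ (2 * k))) (s n' q' : ℕ)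
    (n≡ : suc n' ≡ suc q' * 2) (g : Skew.Poly k FF s) (t p : ℕ) (t≡ : t ≡ p * 2)
    (pal : Skew.Palindromic k FF g t) where
  open Skew k FF
  open RingFacts k k≥1 FF
  open CyclicWords k k≥1 FF s n'
  open ≡-Reasoning

  m : ℕ
  m = suc ((q' * p * 2 ℕ.+ q' ℕ.+ p) * 2)

  θpow-m : ∀ x → θpow m x ≡ θR x
  θpow-m x = cong θR (θpow-even (q' * p * 2 ℕ.+ q' ℕ.+ p) x)

  n*[t+1] : n * suc t ≡ m ℕ.+ suc t
  n*[t+1] = begin
    n * suc t                   ≡⟨ cong₂ (λ a b → a * suc b) n≡ t≡ ⟩
    (suc q' * 2) * suc (p * 2)  ≡⟨ period-split q' p ⟩
    m ℕ.+ suc (p * 2)           ≡⟨ cong (λ z → m ℕ.+ suc z) (sym t≡) ⟩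
    m ℕ.+ suc t ∎

  coefficients : Poly s
  coefficients = tabulateP (coeff g) (suc t)

  g≈coefficients : g ≈P coefficients
  g≈coefficients i with i ℕ.≤? t
  ... | yes i≤t = sym (coeff-tab-< (coeff g) (suc t) i (s≤s i≤t))
  ... | no  i≰t = trans (proj₂ (proj₁ pal) i (ℕP.≰⇒> i≰t)) (sym (coeff-tab-≥ (coeff g) (suc t) i (ℕP.≰⇒> i≰t)))

  coefficients-palindrome : L.reverse coefficients ≡ coefficients
  coefficients-palindrome = trans (reverse-tab (coeff g) t)
    (tabulateP-cong _ _ (suc t) (λ i i<t+1 → sym (proj₂ pal i (ℕP.≤-pred i<t+1))))

  reduce-g : ∀ j → reduce g j ≡ reduce coefficients j
  reduce-g = reduce-≈ g coefficients g≈coefficients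

  reduce-θ-coefficients : reduce (L.map θR coefficients) ≐ rot^ (suc t) (rev (reduce coefficients))
  reduce-θ-coefficients =
    ≐-trans (pointwise (λ j → cong (λ z → reduce (L.map θR z) j) (sym coefficients-palindrome)))
    (≐-trans (reduce-reverse coefficients)
             (pointwise (λ j → cong (λ z → rot^ z (rev (reduce coefficients)) j) (length-tab (coeff g) (suc t)))))

  rev-g : rev (reduce g) ≐ xmul^ m (reduce g)
  rev-g =
    ≐-trans (rev-resp (pointwise reduce-g))
    (≐-trans (≐-sym (rot^-nK (suc t) _))
    (≐-trans (pointwise (λ j → trans (cong (λ z → rot^ z (rev (reduce coefficients)) j) n*[t+1]) (rot^-add m (suc t) _ j)))
    (≐-trans (rot^-resp m (≐-sym reduce-θ-coefficients))
    (pointwise (λ j → begin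
       rot^ m (reduce (L.map θR coefficients)) j  ≡⟨ rot^-pw m (reduce-map-θ coefficients) j ⟩
       rot^ m (λ i → θR (reduce coefficients i)) j ≡⟨ rot^-θ m (reduce coefficients) j ⟩
       θR (rot^ m (reduce coefficients) j)         ≡⟨ sym (θpow-m _) ⟩
       θpow m (rot^ m (reduce coefficients) j)     ≡⟨ sym (xmul^-rot m (reduce coefficients) j) ⟩
       xmul^ m (reduce coefficients) j             ≡⟨ sym (xmul^-pw m reduce-g j) ⟩
       xmul^ m (reduce g) j ∎)))))

module CodeWords (k : ℕ) (k≥1 : 1 ≤ k) (FF : FiniteField (4 ^ (2 * k))) (s n' : ℕ) (g : Skew.Poly k FF s) where
  open Skew k FF
  open RingFacts k k≥1 FF
  open CyclicWords k k≥1 FF s n'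
  open Multiples k k≥1 FF s n' g
  open ≡-Reasoning

  word : Vec (R s) n → Word
  word c = coeff (V.toList c)

  codeword-multiple : ∀ (c : Vec (R s) n) → InCode g c → Multiple (word c)
  codeword-multiple c (f , q , fg≈qX+c) = f , λ j lt → begin
    reduce (mulP f g) j                              ≡⟨ reduce-≈ (mulP f g) (addP (mulP q modulus) (V.toList c)) fg≈qX+c j ⟩
    reduce (addP (mulP q modulus) (V.toList c)) j    ≡⟨ reduce-addP (mulP q modulus) (V.toList c) j ⟩
    addR (reduce (mulP q modulus) j) (reduce (V.toList c) j)
      ≡⟨ cong₂ addR (reduce-mul-modulus q j lt) (reduce-short (V.toList c) (ℕP.≤-reflexive (VP.length-toList c)) j) ⟩
    addR (zeroR s) (word c j)                        ≡⟨ +R-idˡ _ ⟩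
    word c j ∎

  -- By division with remainder, f·g ≡ (its reduction) modulo x^n - 1.
  multiple-codeword : ∀ (c : Vec (R s) n) → Multiple (word c) → InCode g c
  multiple-codeword c (f , fg≐c) with divide (mulP f g)
  ... | Q , fg≈QX+r = f , Q , λ i → begin
    coeff (mulP f g) i                                        ≡⟨ fg≈QX+r i ⟩
    coeff (addP (mulP Q modulus) remainder) i                 ≡⟨ coeff-addP (mulP Q modulus) remainder i ⟩
    addR (coeff (mulP Q modulus) i) (coeff remainder i)       ≡⟨ cong (addR (coeff (mulP Q modulus) i)) (remainder≈c i) ⟩
    addR (coeff (mulP Q modulus) i) (coeff (V.toList c) i)    ≡⟨ sym (coeff-addP (mulP Q modulus) (V.toList c) i) ⟩
    coeff (addP (mulP Q modulus) (V.toList c)) i ∎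
    where
    remainder : Poly s
    remainder = tabulateP (reduce (mulP f g)) n
    remainder≈c : remainder ≈P V.toList c
    remainder≈c i with i ℕ.<? n
    ... | yes i<n = trans (coeff-tab-< (reduce (mulP f g)) n i i<n) (fg≐c i i<n)
    ... | no  i≮n = trans (coeff-tab-≥ (reduce (mulP f g)) n i (ℕP.≮⇒≥ i≮n))
                          (sym (coeff-beyond (V.toList c) i (subst (_≤ i) (sym (VP.length-toList c)) (ℕP.≮⇒≥ i≮n))))

  word-θrev : ∀ (c : Vec (R s) n) → word (θrev c) ≐ rev (word c)
  word-θrev c i i<n = begin
    coeff (V.toList (θrev c)) i              ≡⟨ cong (λ z → coeff z i) toList-θrev ⟩
    coeff (L.map θR (L.reverse (V.toList c))) i ≡⟨ coeff-map θR θR-0 (L.reverse (V.toList c)) i ⟩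
    θR (coeff (L.reverse (V.toList c)) i)    ≡⟨ cong θR (coeff-reverse (V.toList c) n' (VP.length-toList c) i (ℕP.≤-pred i<n)) ⟩
    θR (coeff (V.toList c) (n' ∸ i)) ∎
    where
    toList-θrev : V.toList (θrev c) ≡ L.map θR (L.reverse (V.toList c))
    toList-θrev = trans (VP.toList-map θR (V.reverse c)) (cong (L.map θR) (VP.toList-reverse c))

-- The skew cyclic code (g) of even length is closed under c ↦ θrev c when g is
-- palindromic of even degree: pass to coefficient words, apply rev, and return.
code-θrev-closed : ∀ k (k≥1 : 1 ≤ k) (FF : FiniteField (4 ^ (2 * k))) s n half → n ≡ half * 2 →
                   let open Skew k FF in
                   (g : Poly s) (t p : ℕ) → t ≡ p * 2 → Palindromic g t →
                   (c : Vec (R s) n) → InCode g c → InCode g (θrev c)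
code-θrev-closed k k≥1 FF s zero     half     n≡ g t p t≡ pal V.[] c∈C = c∈C
code-θrev-closed k k≥1 FF s (suc n') zero     ()
code-θrev-closed k k≥1 FF s (suc n') (suc q') n≡ g t p t≡ pal c c∈C =
  multiple-codeword (θrev c) (Multiple-resp (Multiple-rev (codeword-multiple c c∈C)) (≐-sym (word-θrev c)))
  where
  open Skew k FF using (θrev)
  open CyclicWords k k≥1 FF s n' using (≐-sym)
  open Multiples k k≥1 FF s n' g using (Multiple-resp)
  open PalindromicReversal k k≥1 FF s n' q' n≡ g t p t≡ pal using (m; rev-g)
  open Multiples.ReversalClosed k k≥1 FF s n' g (suc q') n≡ m rev-g using (Multiple-rev)
  open CodeWords k k≥1 FF s n' g using (codeword-multiple; multiple-codeword; word-θrev)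

-- Theorem 5: φ(C) is a reversible DNA code. The DNA reverse of φ(c) is φ(θrev c),
-- which exists since the Gray map is total, and θrev c ∈ C.
theorem5 : (k s n : ℕ) → 1 ≤ k → 1 ≤ s → 2 ∣ n →
           (FF : FiniteField (4 ^ (2 * k))) →
           let open Skew k FF in
           (g : Poly s) (t : ℕ) →
           RightDivides g n → HasDegree g t → 2 ∣ t →
           Palindromic g t →
           ReversibleDNA s n (InCode g)
theorem5 k s n k≥1 _ (divides half n≡) FF g t _ _ (divides p t≡) pal c c∈C
  with GrayFacts.grayWord k k≥1 FF (Skew.θrev k FF c)
... | v , φ[θrev-c]≡v =
  Skew.θrev k FF c , code-θrev-closed k k≥1 FF s n half n≡ g t p t≡ pal c c∈C , v , φ[θrev-c]≡v , φ[θrev-c]≡v
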